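{- Let $v,\lambda$ be positive integers with $(v,\lambda)\notin\{(3,1),(6,2)\}$, and suppose either $v\equiv 3\pmod 6$, or $v\equiv 0\pmod 6$ and $\lambda$ is even. Then there exists a $\mathrm{TS}(v,\lambda)$ with a zero-sum $3$-flow.
   Context: A $\mathrm{TS}(v,\lambda)$ (triple system) is a pair $(X,\mathcal B)$ where $X$ is a set of $v$ points and $\mathcal B$ is a collection (multiset) of $3$-subsets of $X$, called blocks, such that every $2$-subset of $X$ is contained in exactly $\lambda$ blocks. For a positive integer $n$, a zero-sum $n$-flow of such a design is a map $f:\mathcal B\to\{\pm1,\dots,\pm(n-1)\}$ such that for every point $x\in X$, $\sum_{B\ni x} f(B)=0$. -}

module Defs where

open import Data.Nat using (ℕ; zero; suc; _+_)
open import Data.Integer as ℤ using (ℤ; +_; -[1+_])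
open import Data.Fin using (Fin)
open import Data.Product using (_×_; _,_; proj₁; proj₂; Σ; ∃)
open import Data.List using (List; []; _∷_; length; map; filter; sum)
open import Data.List.Relation.Unary.All using (All)
open import Relation.Binary.PropositionalEquality using (_≡_; _≢_)
open import Relation.Nullary using (¬_; Dec; yes; no)
open import Relation.Nullary.Decidable using (_⊎-dec_; _×-dec_)
open import Data.Sum using (_⊎_)
import Data.Fin.Properties as FinP

-- A block is an ordered triple of points; it represents the 3-subset
-- {a , b , c} and is required to have three distinct entries.
Block : ℕ → Set
Block v = Fin v × Fin v × Fin v

_∈B_ : {v : ℕ} → Fin v → Block v → Set
x ∈B (a , b , c) = (x ≡ a) ⊎ (x ≡ b) ⊎ (x ≡ c)

_∈B?_ : {v : ℕ} (x : Fin v) (B : Block v) → Dec (x ∈B B)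
x ∈B? (a , b , c) = (x FinP.≟ a) ⊎-dec ((x FinP.≟ b) ⊎-dec (x FinP.≟ c))

ProperBlock : {v : ℕ} → Block v → Set
ProperBlock (a , b , c) = (a ≢ b) × (a ≢ c) × (b ≢ c)

pairCount : {v : ℕ} → List (Block v) → Fin v → Fin v → ℕ
pairCount Bs x y = length (filter (λ B → (x ∈B? B) ×-dec (y ∈B? B)) Bs)

-- TS(v, λ): a multiset (list) of 3-subsets of Fin v such that every
-- 2-subset {x, y} lies in exactly λ blocks.
IsTS : (v l : ℕ) → List (Block v) → Set
IsTS v l Bs = All ProperBlock Bs
            × (∀ (x y : Fin v) → x ≢ y → pairCount Bs x y ≡ l)

FlowValue : ℕ → ℤ → Set
FlowValue n z = (z ≢ + 0) × (ℤ.∣ z ∣ Data.Nat.< n)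
  where import Data.Nat

flowAt : {v : ℕ} → List (Block v × ℤ) → Fin v → ℤ
flowAt [] x = + 0
flowAt ((B , z) ∷ fs) x with x ∈B? B
... | yes _ = z ℤ.+ flowAt fs x
... | no  _ = flowAt fs x

-- A design (the blocks, i.e. first components) together with a
-- zero-sum n-flow (the second components, one value per block).
IsZeroSumFlow : (n v : ℕ) → List (Block v × ℤ) → Set
IsZeroSumFlow n v fs = All (λ p → FlowValue n (proj₂ p)) fs
                     × (∀ (x : Fin v) → flowAt fs x ≡ + 0)

HasTSWithFlow : (n v l : ℕ) → Set
HasTSWithFlow n v l = Σ (List (Block v × ℤ)) λ fs →
  IsTS v l (map proj₁ fs) × IsZeroSumFlow n v fs

-- Bose's Steiner triple system on ℤ₃ × ℤₙ (n = 2m + 1) consists of the triangles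
-- {(l, a), (l, a + 2k), (l + 1, a + k)} for the offsets 1 ≤ k ≤ m and the verticals
-- {(0, a), (1, a), (2, a)}.  Give the triangles of offset k ≥ 2 the weight ±1,
-- alternating in k, and those of offset 1 the weight 1 + s·[3 ∣ a]: a point of residue z
-- then receives from the triangles 3·(-1 + 1 - ⋯) + 3 + s·c, where c ∈ {1, 2} counts the
-- multiples of 3 among z - 2, z - 1, z, and the vertical through the point cancels this
-- with a value in {±1, ±2} once the sign s is chosen by the parity of m.  For
-- v = 6m + 6, adjoin points ∞₀, ∞₁, ∞₂ to two copies of the Bose system, weighted 1 and
-- -1, and replace the second copy of each offset-1 triangle T by the three blocks joining
-- ∞ⱼ to a side of T; these and T get weights depending only on the level, chosen so that
-- they cancel at every point.  Every other admissible (v, λ) is r ≥ 2 copies of one of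
-- these systems (or of TS(6, 2)) weighted by r values in {±1, ±2} with sum 0.
--
-- Incidences are sums of Kronecker deltas over ℤ₃ × ℤₙ, and the blocks of a family of
-- translates that pass through a point are found by reindexing these sums along the
-- translations.
module Submission where

open import Defs
open import Algebra.Properties.Semiring.Sum as Sum using ()
open import Data.Bool.Base using (true; false; if_then_else_)
open import Data.Empty using (⊥; ⊥-elim)
open import Data.Fin.Base using (Fin; zero; suc; toℕ; fromℕ<; combine; _↑ˡ_; _↑ʳ_; splitAt)
open import Data.Fin.Patterns using (0F; 1F; 2F; 3F; 4F; 5F)
open import Data.Fin.Permutation as Perm using (Permutation′; permutation; _⟨$⟩ʳ_; _⟨$⟩ˡ_; inverseˡ; inverseʳ)
import Data.Fin.Properties as Fin
open import Data.Fin.Properties using (_≟_)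
import Data.Integer.Base as ℤ
open import Data.Integer.Base using (ℤ; +_; -[1+_]; 0ℤ; 1ℤ; -1ℤ)
import Data.Integer.Properties as ℤP
open import Data.Integer.Tactic.RingSolver using (solve-∀)
open import Data.List.Base using (List; []; _∷_; _++_; [_]; map; concat; tabulate; filter; length; foldr)
import Data.List.Properties as List
open import Data.List.Relation.Unary.All using (All; []; _∷_; universal)
import Data.List.Relation.Unary.All as All using (all?)
import Data.List.Relation.Unary.All.Properties as All
open import Data.Nat.Base as ℕ using (ℕ; zero; suc; NonZero; _≤_; _<_; _%_; _/_; z≤n; s≤s)
open import Data.Nat.DivMod using (_mod_; m%n%n≡m%n; %-distribˡ-+; [m+kn]%n≡m%n; m<n⇒m%n≡m; m≡m%n+[m/n]*n; m%n<n)
import Data.Nat.Properties as ℕP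
import Data.Nat.Tactic.RingSolver as ℕ-Solver
open import Data.Product.Base using (_×_; _,_; proj₁; proj₂; ∃; Σ-syntax)
open import Data.Sum.Base using (_⊎_; inj₁; inj₂)
open import Function.Base using (_∘_)
open import Function.Definitions using (Injective)
open import Level using (Level)
open import Relation.Binary.Definitions using (DecidableEquality)
open import Relation.Binary.PropositionalEquality
  using (_≡_; _≢_; refl; sym; trans; cong; cong₂; subst; subst₂; module ≡-Reasoning)
open import Relation.Nullary using (Dec; does; yes; no; ¬_; ¬?; contradiction)
open import Relation.Nullary.Decidable using (_×-dec_; _→-dec_; True; toWitness)

module Cyclic (n : ℕ) .{{_ : NonZero n}} where

  open import Data.Nat.Base using (_+_; _*_; _∸_)

  residue : ℕ → Fin n
  residue c = c mod n

  toℕ-residue : ∀ c → toℕ (residue c) ≡ c % n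
  toℕ-residue c = Fin.toℕ-fromℕ< (m%n<n c n)

  residue-cong : ∀ {c d} → c % n ≡ d % n → residue c ≡ residue d
  residue-cong {c} {d} eq = Fin.toℕ-injective (trans (toℕ-residue c) (trans eq (sym (toℕ-residue d))))

  residue-toℕ : ∀ a → residue (toℕ a) ≡ a
  residue-toℕ a = Fin.toℕ-injective (trans (toℕ-residue (toℕ a)) (m<n⇒m%n≡m (Fin.toℕ<n a)))

  infixl 6 _⊕_ _⊖_

  _⊕_ : Fin n → ℕ → Fin n
  a ⊕ c = residue (toℕ a + c)

  _⊖_ : Fin n → ℕ → Fin n
  a ⊖ c = a ⊕ (n ∸ c % n)

  residue-⊕ : ∀ c d → residue c ⊕ d ≡ residue (c + d)
  residue-⊕ c d = residue-cong (begin
    (toℕ (residue c) + d) % n   ≡⟨ cong (λ t → (t + d) % n) (toℕ-residue c) ⟩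
    (c % n + d) % n             ≡⟨ %-distribˡ-+ (c % n) d n ⟩
    (c % n % n + d % n) % n     ≡⟨ cong (λ t → (t + d % n) % n) (m%n%n≡m%n c n) ⟩
    (c % n + d % n) % n         ≡⟨ %-distribˡ-+ c d n ⟨
    (c + d) % n                 ∎)
    where open ≡-Reasoning

  ⊕-assoc : ∀ a c d → a ⊕ c ⊕ d ≡ a ⊕ (c + d)
  ⊕-assoc a c d = trans (residue-⊕ (toℕ a + c) d) (cong residue (ℕP.+-assoc (toℕ a) c d))

  ⊕-identityʳ : ∀ a → a ⊕ 0 ≡ a
  ⊕-identityʳ a = trans (cong residue (ℕP.+-identityʳ (toℕ a))) (residue-toℕ a)

  ⊕-multiple : ∀ a k → a ⊕ k * n ≡ a
  ⊕-multiple a k = trans (residue-cong ([m+kn]%n≡m%n (toℕ a) k n)) (residue-toℕ a)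

  ⊕-comm : ∀ a c → a ⊕ c ≡ residue c ⊕ toℕ a
  ⊕-comm a c = trans (cong residue (ℕP.+-comm (toℕ a) c)) (sym (residue-⊕ c (toℕ a)))

  private
    ⊖-offset : ∀ c → n ∸ c % n + c ≡ suc (c / n) * n
    ⊖-offset c = begin
      n ∸ c % n + c                    ≡⟨ cong (_+_ (n ∸ c % n)) (m≡m%n+[m/n]*n c n) ⟩
      n ∸ c % n + (c % n + c / n * n)  ≡⟨ ℕP.+-assoc (n ∸ c % n) (c % n) _ ⟨
      n ∸ c % n + c % n + c / n * n    ≡⟨ cong (_+ c / n * n) (ℕP.m∸n+n≡m (ℕP.<⇒≤ (m%n<n c n))) ⟩
      n + c / n * n                    ∎
      where open ≡-Reasoning

  ⊖-⊕ : ∀ a c → a ⊖ c ⊕ c ≡ a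
  ⊖-⊕ a c = trans (⊕-assoc a (n ∸ c % n) c) (trans (cong (a ⊕_) (⊖-offset c)) (⊕-multiple a (suc (c / n))))

  ⊕-⊖ : ∀ a c → a ⊕ c ⊖ c ≡ a
  ⊕-⊖ a c = trans (⊕-assoc a c (n ∸ c % n))
              (trans (cong (a ⊕_) (trans (ℕP.+-comm c (n ∸ c % n)) (⊖-offset c))) (⊕-multiple a (suc (c / n))))

  ⊕-cancelʳ : ∀ {a b} c → a ⊕ c ≡ b ⊕ c → a ≡ b
  ⊕-cancelʳ {a} {b} c e = trans (sym (⊕-⊖ a c)) (trans (cong (_⊖ c) e) (⊕-⊖ b c))

  ⊖-unique : ∀ {a z} c → a ⊕ c ≡ z → z ⊖ c ≡ a
  ⊖-unique {a} c refl = ⊕-⊖ a c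

  ⊖[+]-⊕ : ∀ a c d → a ⊖ (c + d) ⊕ c ≡ a ⊖ d
  ⊖[+]-⊕ a c d = ⊕-cancelʳ d (trans (⊕-assoc (a ⊖ (c + d)) c d) (trans (⊖-⊕ a (c + d)) (sym (⊖-⊕ a d))))

  ⊖-⊕[+] : ∀ a c d → a ⊖ c ⊕ (c + d) ≡ a ⊕ d
  ⊖-⊕[+] a c d = trans (sym (⊕-assoc (a ⊖ c) c d)) (cong (_⊕ d) (⊖-⊕ a c))

  rotation : ℕ → Permutation′ n
  rotation c = permutation (_⊕ c) (_⊖ c) (λ a → ⊖-⊕ a c) (λ a → ⊕-⊖ a c)

  diff : Fin n → Fin n → ℕ
  diff w z = toℕ (w ⊖ toℕ z)

  diff<n : ∀ w z → diff w z < n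
  diff<n w z = Fin.toℕ<n (w ⊖ toℕ z)

  ≡⊕⇒diff : ∀ {w z c} → c < n → w ≡ z ⊕ c → diff w z ≡ c
  ≡⊕⇒diff {z = z} {c} c<n refl = begin
    toℕ (z ⊕ c ⊖ toℕ z)                ≡⟨ cong (λ a → toℕ (a ⊖ toℕ z)) (⊕-comm z c) ⟩
    toℕ (residue c ⊕ toℕ z ⊖ toℕ z)    ≡⟨ cong toℕ (⊕-⊖ (residue c) (toℕ z)) ⟩
    toℕ (residue c)                    ≡⟨ toℕ-residue c ⟩
    c % n                              ≡⟨ m<n⇒m%n≡m c<n ⟩
    c                                  ∎
    where open ≡-Reasoning

  diff⇒≡⊕ : ∀ {w z c} → diff w z ≡ c → w ≡ z ⊕ c
  diff⇒≡⊕ {w} {z} {c} d≡c = begin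
    w                            ≡⟨ ⊖-⊕ w (toℕ z) ⟨
    w ⊖ toℕ z ⊕ toℕ z            ≡⟨ cong (_⊕ toℕ z) (residue-toℕ (w ⊖ toℕ z)) ⟨
    residue (diff w z) ⊕ toℕ z   ≡⟨ cong (λ t → residue t ⊕ toℕ z) d≡c ⟩
    residue c ⊕ toℕ z            ≡⟨ ⊕-comm z c ⟨
    z ⊕ c                        ∎
    where open ≡-Reasoning

  diff-self : ∀ z → diff z z ≡ 0
  diff-self z = ≡⊕⇒diff (ℕ.>-nonZero⁻¹ n) (sym (⊕-identityʳ z))

  diff-positive : ∀ {w z} → w ≢ z → 1 ≤ diff w z
  diff-positive {w} {z} w≢z = ℕP.n≢0⇒n>0 (λ d≡0 → w≢z (trans (diff⇒≡⊕ d≡0) (⊕-identityʳ z)))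

  diff-+-diff : ∀ {w z} → w ≢ z → diff w z + diff z w ≡ n
  diff-+-diff {w} {z} w≢z = begin
    d + diff z w   ≡⟨ cong (_+_ d) (≡⊕⇒diff (ℕP.∸-monoʳ-< (diff-positive w≢z) (ℕP.<⇒≤ (diff<n w z))) z≡w⊕n∸d) ⟩
    d + (n ∸ d)    ≡⟨ ℕP.m+[n∸m]≡n (ℕP.<⇒≤ (diff<n w z)) ⟩
    n              ∎
    where
    open ≡-Reasoning
    d = diff w z
    z≡w⊕n∸d : z ≡ w ⊕ (n ∸ d)
    z≡w⊕n∸d = begin
      z                  ≡⟨ ⊕-⊖ z d ⟨
      z ⊕ d ⊖ d          ≡⟨ cong (_⊖ d) (diff⇒≡⊕ refl) ⟨
      w ⊕ (n ∸ d % n)    ≡⟨ cong (λ t → w ⊕ (n ∸ t)) (m<n⇒m%n≡m (diff<n w z)) ⟩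
      w ⊕ (n ∸ d)        ∎

  toℕ-⊖ : ∀ {c} z → c ≤ toℕ z → toℕ (z ⊖ c) ≡ toℕ z ∸ c
  toℕ-⊖ {c} z c≤z = begin
    toℕ (z ⊖ c)                 ≡⟨ cong toℕ (⊖-unique c back) ⟩
    toℕ (residue (toℕ z ∸ c))   ≡⟨ toℕ-residue (toℕ z ∸ c) ⟩
    (toℕ z ∸ c) % n             ≡⟨ m<n⇒m%n≡m (ℕP.≤-<-trans (ℕP.m∸n≤m (toℕ z) c) (Fin.toℕ<n z)) ⟩
    toℕ z ∸ c                   ∎
    where
    open ≡-Reasoning
    back : residue (toℕ z ∸ c) ⊕ c ≡ z
    back = trans (residue-⊕ (toℕ z ∸ c) c) (trans (cong residue (ℕP.m∸n+n≡m c≤z)) (residue-toℕ z))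

  toℕ-⊖-wrap : ∀ {c} z → toℕ z < c → c ≤ n → toℕ (z ⊖ c) ≡ toℕ z + (n ∸ c)
  toℕ-⊖-wrap {c} z z<c c≤n = begin
    toℕ (z ⊖ c)                       ≡⟨ cong toℕ (⊖-unique c back) ⟩
    toℕ (residue (toℕ z + (n ∸ c)))   ≡⟨ toℕ-residue (toℕ z + (n ∸ c)) ⟩
    (toℕ z + (n ∸ c)) % n             ≡⟨ m<n⇒m%n≡m (subst (toℕ z + (n ∸ c) <_) (ℕP.m+[n∸m]≡n c≤n) below) ⟩
    toℕ z + (n ∸ c)                   ∎
    where
    open ≡-Reasoning
    below : toℕ z + (n ∸ c) < c + (n ∸ c)
    below = ℕP.+-monoˡ-< (n ∸ c) z<c
    back : residue (toℕ z + (n ∸ c)) ⊕ c ≡ z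
    back = begin
      residue (toℕ z + (n ∸ c)) ⊕ c   ≡⟨ residue-⊕ (toℕ z + (n ∸ c)) c ⟩
      residue (toℕ z + (n ∸ c) + c)   ≡⟨ cong residue (ℕP.+-assoc (toℕ z) (n ∸ c) c) ⟩
      residue (toℕ z + (n ∸ c + c))   ≡⟨ cong (λ t → residue (toℕ z + t)) (ℕP.m∸n+n≡m c≤n) ⟩
      z ⊕ n                           ≡⟨ cong (z ⊕_) (ℕP.+-identityʳ n) ⟨
      z ⊕ 1 * n                       ≡⟨ ⊕-multiple z 1 ⟩
      z                               ∎

open import Data.Integer.Base using (_+_; _*_; -_; _-_)

open Sum ℤP.+-*-semiring
  using (sum-syntax; sum-cong-≗; ∑-distrib-+; ∑-comm; sum-replicate-zero; *-distribˡ-sum; *-distribʳ-sum)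

private variable
  ℓ ℓ′ : Level
  P : Set ℓ
  Q : Set ℓ′
  N V : ℕ
  X Y : Set

𝟙 : Dec P → ℤ
𝟙 d = if does d then 1ℤ else 0ℤ

𝟙-yes : P → (d : Dec P) → 𝟙 d ≡ 1ℤ
𝟙-yes x (yes _) = refl
𝟙-yes x (no ¬x) = contradiction x ¬x

𝟙-no : ¬ P → (d : Dec P) → 𝟙 d ≡ 0ℤ
𝟙-no ¬x (yes x) = contradiction x ¬x
𝟙-no ¬x (no _)  = refl

𝟙-⇔ : (P → Q) → (Q → P) → (p : Dec P) (q : Dec Q) → 𝟙 p ≡ 𝟙 q
𝟙-⇔ f g (yes x) q = sym (𝟙-yes (f x) q)
𝟙-⇔ f g (no ¬x) q = sym (𝟙-no (λ y → ¬x (g y)) q)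

𝟙-×-dec : (p : Dec P) (q : Dec Q) → 𝟙 (p ×-dec q) ≡ 𝟙 p * 𝟙 q
𝟙-×-dec (yes _) (yes _) = refl
𝟙-×-dec (yes _) (no _)  = refl
𝟙-×-dec (no _)  _       = refl

δ : Fin N → Fin N → ℤ
δ x y = 𝟙 (x ≟ y)

δ-refl : ∀ (x : Fin N) → δ x x ≡ 1ℤ
δ-refl x = 𝟙-yes refl (x ≟ x)

δ-≢ : ∀ {x y : Fin N} → x ≢ y → δ x y ≡ 0ℤ
δ-≢ {x = x} {y} x≢y = 𝟙-no x≢y (x ≟ y)

δ-injective : ∀ {M} {f : Fin M → Fin N} → Injective _≡_ _≡_ f → ∀ x y → δ (f x) (f y) ≡ δ x y
δ-injective f-injective x y = 𝟙-⇔ f-injective (cong _) (_ ≟ _) (x ≟ y)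

δ-δ-≢ : ∀ {x y : Fin N} → x ≢ y → ∀ p → δ x p * δ y p ≡ 0ℤ
δ-δ-≢ {x = x} {y} x≢y p with x ≟ p
... | yes refl = trans (ℤP.*-identityˡ (δ y x)) (𝟙-no (λ y≡x → x≢y (sym y≡x)) (y ≟ x))
... | no _     = refl

∑-δ : ∀ (z : Fin N) (g : Fin N → ℤ) → ∑[ a < N ] (δ z a * g a) ≡ g z
∑-δ {suc N} zero g = begin
  1ℤ * g zero + ∑[ a < N ] 0ℤ   ≡⟨ cong₂ _+_ (ℤP.*-identityˡ (g zero)) (sum-replicate-zero N) ⟩
  g zero + 0ℤ                   ≡⟨ ℤP.+-identityʳ (g zero) ⟩
  g zero                        ∎
  where open ≡-Reasoning
∑-δ {suc N} (suc z) g = trans (ℤP.+-identityˡ _) (∑-δ z (g ∘ suc))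

∑-δ-1 : ∀ (z : Fin N) → ∑[ a < N ] δ z a ≡ 1ℤ
∑-δ-1 z = trans (sum-cong-≗ (λ a → sym (ℤP.*-identityʳ (δ z a)))) (∑-δ z (λ _ → 1ℤ))

∑-δ-⟨$⟩ʳ : ∀ (π : Permutation′ N) (z : Fin N) (g : Fin N → ℤ) →
           ∑[ a < N ] (δ z (π ⟨$⟩ʳ a) * g a) ≡ g (π ⟨$⟩ˡ z)
∑-δ-⟨$⟩ʳ π z g = trans (sum-cong-≗ (λ a → cong (_* g a) (moved a))) (∑-δ (π ⟨$⟩ˡ z) g)
  where
  moved : ∀ a → δ z (π ⟨$⟩ʳ a) ≡ δ (π ⟨$⟩ˡ z) a
  moved a = 𝟙-⇔ (λ e → trans (cong (π ⟨$⟩ˡ_) e) (inverseˡ π))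
                (λ e → trans (sym (inverseʳ π)) (cong (π ⟨$⟩ʳ_) e)) (z ≟ _) (_ ≟ a)

module _ {A : Set ℓ} (_≟ᴬ_ : DecidableEquality A) {k : ℕ} (f : Fin k → A) where

  ∑-𝟙-image : Injective _≡_ _≡_ f → ∀ {y} i₀ → y ≡ f i₀ → ∑[ i < k ] 𝟙 (y ≟ᴬ f i) ≡ 1ℤ
  ∑-𝟙-image f-injective i₀ y≡ =
    trans (sum-cong-≗ (λ i → 𝟙-⇔ (λ e → f-injective (trans (sym y≡) e)) (λ e → trans y≡ (cong f e)) (_ ≟ᴬ f i) (i₀ ≟ i)))
          (∑-δ-1 i₀)

  ∑-𝟙-∉ : ∀ {y} → (∀ i → y ≢ f i) → ∑[ i < k ] 𝟙 (y ≟ᴬ f i) ≡ 0ℤ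
  ∑-𝟙-∉ {y} y∉ = trans (sum-cong-≗ (λ i → 𝟙-no (y∉ i) (y ≟ᴬ f i))) (sum-replicate-zero k)

module _ {r N : ℕ} where

  ∑∑-distrib-+ : ∀ (f g : Fin r → Fin N → ℤ) →
    ∑[ l < r ] ∑[ a < N ] (f l a + g l a) ≡ ∑[ l < r ] ∑[ a < N ] f l a + ∑[ l < r ] ∑[ a < N ] g l a
  ∑∑-distrib-+ f g = trans (sum-cong-≗ λ l → ∑-distrib-+ (f l) (g l))
                           (∑-distrib-+ (λ l → ∑[ a < N ] f l a) (λ l → ∑[ a < N ] g l a))

  ∑∑-distribˡ : ∀ c (f : Fin r → Fin N → ℤ) → c * ∑[ l < r ] ∑[ a < N ] f l a ≡ ∑[ l < r ] ∑[ a < N ] (c * f l a)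
  ∑∑-distribˡ c f = trans (*-distribˡ-sum c (λ l → ∑[ a < N ] f l a)) (sum-cong-≗ λ l → *-distribˡ-sum c (f l))

  ∑∑-zero : ∀ {f : Fin r → Fin N → ℤ} → (∀ l a → f l a ≡ 0ℤ) → ∑[ l < r ] ∑[ a < N ] f l a ≡ 0ℤ
  ∑∑-zero f≡0 = trans (sum-cong-≗ λ l → trans (sum-cong-≗ (f≡0 l)) (sum-replicate-zero N)) (sum-replicate-zero r)

⋃-syntax : ∀ N → (Fin N → List X) → List X
⋃-syntax _ f = concat (tabulate f)

syntax ⋃-syntax N (λ a → L) = ⋃[ a < N ] L

map-⋃ : ∀ (f : X → Y) (g : Fin N → List X) → map f (⋃[ a < N ] g a) ≡ ⋃[ a < N ] map f (g a)
map-⋃ {N = zero}  f g = refl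
map-⋃ {N = suc N} f g = trans (List.map-++ f (g zero) _) (cong (map f (g zero) ++_) (map-⋃ f (g ∘ suc)))

⋃-cong : ∀ {g h : Fin N → List X} → (∀ a → g a ≡ h a) → ⋃[ a < N ] g a ≡ ⋃[ a < N ] h a
⋃-cong g≗h = cong concat (List.tabulate-cong g≗h)

All-⋃ : ∀ {P : X → Set} (g : Fin N → List X) → (∀ a → All P (g a)) → All P (⋃[ a < N ] g a)
All-⋃ g all = All.concat⁺ (All.tabulate⁺ all)

χ : Fin V → Block V → ℤ
χ x B = 𝟙 (x ∈B? B)

corner : Block V → Fin 3 → Fin V
corner (a , b , c) 0F = a
corner (a , b , c) 1F = b
corner (a , b , c) 2F = c

χ-proper : ∀ {B : Block V} → ProperBlock B → ∀ x → χ x B ≡ ∑[ s < 3 ] δ x (corner B s)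
χ-proper {B = a , b , c} (a≢b , a≢c , b≢c) x with x ≟ a | x ≟ b | x ≟ c
... | yes refl | yes refl | _        = ⊥-elim (a≢b refl)
... | yes refl | no _     | yes refl = ⊥-elim (a≢c refl)
... | yes refl | no _     | no _     = refl
... | no _     | yes refl | yes refl = ⊥-elim (b≢c refl)
... | no _     | yes _    | no _     = refl
... | no _     | no _     | yes _    = refl
... | no _     | no _     | no _     = refl

χ-absent : ∀ {B : Block V} → ProperBlock B → ∀ x → (∀ s → x ≢ corner B s) → χ x B ≡ 0ℤ
χ-absent proper x x∉ = trans (χ-proper proper x)
  (cong₂ _+_ (δ-≢ (x∉ 0F)) (cong₂ _+_ (δ-≢ (x∉ 1F)) (cong (_+ 0ℤ) (δ-≢ (x∉ 2F)))))

pairCount-++ : ∀ (Bs Cs : List (Block V)) x y →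
               pairCount (Bs ++ Cs) x y ≡ pairCount Bs x y ℕ.+ pairCount Cs x y
pairCount-++ Bs Cs x y = trans (cong length (List.filter-++ _ Bs Cs)) (List.length-++ (filter _ Bs))

pairCountℤ : List (Block V) → Fin V → Fin V → ℤ
pairCountℤ Bs x y = + pairCount Bs x y

pairCountℤ-++ : ∀ (Bs Cs : List (Block V)) x y →
                pairCountℤ (Bs ++ Cs) x y ≡ pairCountℤ Bs x y + pairCountℤ Cs x y
pairCountℤ-++ Bs Cs x y = trans (cong +_ (pairCount-++ Bs Cs x y)) (ℤP.pos-+ (pairCount Bs x y) _)

pairCount-[_] : ∀ (B : Block V) x y → pairCountℤ [ B ] x y ≡ χ x B * χ y B
pairCount-[ B ] x y = trans single (𝟙-×-dec (x ∈B? B) (y ∈B? B))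
  where
  single : pairCountℤ [ B ] x y ≡ 𝟙 (x ∈B? B ×-dec y ∈B? B)
  single with does (x ∈B? B ×-dec y ∈B? B)
  ... | true  = refl
  ... | false = refl

pairCount-∷ : ∀ (B : Block V) Bs x y → pairCountℤ (B ∷ Bs) x y ≡ χ x B * χ y B + pairCountℤ Bs x y
pairCount-∷ B Bs x y = trans (pairCountℤ-++ [ B ] Bs x y) (cong (_+ pairCountℤ Bs x y) (pairCount-[ B ] x y))

pairCount-⋃ : ∀ (g : Fin N → List (Block V)) x y →
              pairCountℤ (⋃[ a < N ] g a) x y ≡ ∑[ a < N ] (pairCountℤ (g a) x y)
pairCount-⋃ {N = zero}  g x y = refl
pairCount-⋃ {N = suc N} g x y =
  trans (pairCountℤ-++ (g zero) _ x y) (cong (_+_ (pairCountℤ (g zero) x y)) (pairCount-⋃ (g ∘ suc) x y))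

pairCount-comm : ∀ (Bs : List (Block V)) x y → pairCount Bs x y ≡ pairCount Bs y x
pairCount-comm []       x y = refl
pairCount-comm (B ∷ Bs) x y = ℤP.+-injective (begin
  pairCountℤ ([ B ] ++ Bs) x y               ≡⟨ pairCountℤ-++ [ B ] Bs x y ⟩
  pairCountℤ [ B ] x y + pairCountℤ Bs x y   ≡⟨ cong₂ _+_ (trans (pairCount-[ B ] x y) (ℤP.*-comm (χ x B) (χ y B)))
                                                         (cong +_ (pairCount-comm Bs x y)) ⟩
  χ y B * χ x B + pairCountℤ Bs y x          ≡⟨ cong (_+ pairCountℤ Bs y x) (pairCount-[ B ] y x) ⟨
  pairCountℤ [ B ] y x + pairCountℤ Bs y x   ≡⟨ pairCountℤ-++ [ B ] Bs y x ⟨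
  pairCountℤ ([ B ] ++ Bs) y x               ∎)
  where open ≡-Reasoning

pairCount-absent : ∀ {Bs : List (Block V)} x {y} → All (λ B → χ y B ≡ 0ℤ) Bs → pairCountℤ Bs x y ≡ 0ℤ
pairCount-absent x []                        = refl
pairCount-absent {Bs = B ∷ Bs} x {y} (χ≡0 ∷ χs≡0) = begin
  pairCountℤ (B ∷ Bs) x y                    ≡⟨ pairCount-∷ B Bs x y ⟩
  χ x B * χ y B + pairCountℤ Bs x y          ≡⟨ cong₂ (λ c p → χ x B * c + p) χ≡0 (pairCount-absent x χs≡0) ⟩
  χ x B * 0ℤ + 0ℤ                            ≡⟨ cong (_+ 0ℤ) (ℤP.*-zeroʳ (χ x B)) ⟩
  0ℤ                                         ∎
  where open ≡-Reasoning

flowAt-∷ : ∀ (B : Block V) w fs x → flowAt ((B , w) ∷ fs) x ≡ χ x B * w + flowAt fs x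
flowAt-∷ B w fs x with x ∈B? B
... | yes x∈B = trans (cong (_+ flowAt fs x) (sym (ℤP.*-identityˡ w)))
                     (cong (λ t → t * w + flowAt fs x) (sym (𝟙-yes x∈B (x ∈B? B))))
... | no x∉B  = trans (sym (ℤP.+-identityˡ (flowAt fs x)))
                     (cong (λ t → t * w + flowAt fs x) (sym (𝟙-no x∉B (x ∈B? B))))

flowAt-++ : ∀ (fs gs : List (Block V × ℤ)) x → flowAt (fs ++ gs) x ≡ flowAt fs x + flowAt gs x
flowAt-++ []             gs x = sym (ℤP.+-identityˡ (flowAt gs x))
flowAt-++ ((B , w) ∷ fs) gs x = begin
  flowAt ((B , w) ∷ fs ++ gs) x               ≡⟨ flowAt-∷ B w (fs ++ gs) x ⟩
  χ x B * w + flowAt (fs ++ gs) x             ≡⟨ cong (_+_ (χ x B * w)) (flowAt-++ fs gs x) ⟩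
  χ x B * w + (flowAt fs x + flowAt gs x)     ≡⟨ ℤP.+-assoc (χ x B * w) _ _ ⟨
  (χ x B * w + flowAt fs x) + flowAt gs x     ≡⟨ cong (_+ flowAt gs x) (flowAt-∷ B w fs x) ⟨
  flowAt ((B , w) ∷ fs) x + flowAt gs x       ∎
  where open ≡-Reasoning

flowAt-⋃ : ∀ (g : Fin N → List (Block V × ℤ)) x → flowAt (⋃[ a < N ] g a) x ≡ ∑[ a < N ] (flowAt (g a) x)
flowAt-⋃ {N = zero}  g x = refl
flowAt-⋃ {N = suc N} g x = trans (flowAt-++ (g zero) _ x) (cong (_+_ (flowAt (g zero) x)) (flowAt-⋃ (g ∘ suc) x))

flowAt-[_] : ∀ (p : Block V × ℤ) x → flowAt [ p ] x ≡ χ x (proj₁ p) * proj₂ p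
flowAt-[ B , w ] x = trans (flowAt-∷ B w [] x) (ℤP.+-identityʳ _)

flowValue? : ∀ k z → Dec (FlowValue k z)
flowValue? k z = ¬? (z ℤP.≟ 0ℤ) ×-dec (ℤ.∣ z ∣ ℕP.<? k)

flowValue : ∀ {k} z → {True (flowValue? k z)} → FlowValue k z
flowValue {k} z {t} = toWitness {a? = flowValue? k z} t

withWeight : ℤ → List (Block V) → List (Block V × ℤ)
withWeight w = map (_, w)

blocks-withWeight : ∀ w (Bs : List (Block V)) → map proj₁ (withWeight w Bs) ≡ Bs
blocks-withWeight w Bs = trans (sym (List.map-∘ Bs)) (List.map-id Bs)

flowAt-withWeight : ∀ w (Bs : List (Block V)) x → flowAt (withWeight w Bs) x ≡ w * flowAt (withWeight 1ℤ Bs) x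
flowAt-withWeight w []       x = sym (ℤP.*-zeroʳ w)
flowAt-withWeight w (B ∷ Bs) x = begin
  flowAt ((B , w) ∷ withWeight w Bs) x             ≡⟨ flowAt-∷ B w _ x ⟩
  χ x B * w + flowAt (withWeight w Bs) x           ≡⟨ cong (_+_ (χ x B * w)) (flowAt-withWeight w Bs x) ⟩
  χ x B * w + w * flowAt (withWeight 1ℤ Bs) x      ≡⟨ factor (χ x B) w (flowAt (withWeight 1ℤ Bs) x) ⟩
  w * (χ x B * 1ℤ + flowAt (withWeight 1ℤ Bs) x)   ≡⟨ cong (w *_) (flowAt-∷ B 1ℤ _ x) ⟨
  w * flowAt ((B , 1ℤ) ∷ withWeight 1ℤ Bs) x        ∎
  where
  open ≡-Reasoning
  factor : ∀ c w d → c * w + w * d ≡ w * (c * 1ℤ + d)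
  factor = solve-∀

copies : List ℤ → List (Block V) → List (Block V × ℤ)
copies []       Bs = []
copies (w ∷ ws) Bs = withWeight w Bs ++ copies ws Bs

module _ (Bs : List (Block V)) where

  pairCount-copies : ∀ ws x y → pairCount (map proj₁ (copies ws Bs)) x y ≡ length ws ℕ.* pairCount Bs x y
  pairCount-copies []       x y = refl
  pairCount-copies (w ∷ ws) x y = begin
    pairCount (map proj₁ (withWeight w Bs ++ copies ws Bs)) x y
      ≡⟨ cong (λ Cs → pairCount Cs x y) (List.map-++ proj₁ (withWeight w Bs) (copies ws Bs)) ⟩
    pairCount (map proj₁ (withWeight w Bs) ++ map proj₁ (copies ws Bs)) x y
      ≡⟨ pairCount-++ (map proj₁ (withWeight w Bs)) _ x y ⟩
    pairCount (map proj₁ (withWeight w Bs)) x y ℕ.+ pairCount (map proj₁ (copies ws Bs)) x y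
      ≡⟨ cong₂ ℕ._+_ (cong (λ Cs → pairCount Cs x y) (blocks-withWeight w Bs)) (pairCount-copies ws x y) ⟩
    pairCount Bs x y ℕ.+ length ws ℕ.* pairCount Bs x y ∎
    where open ≡-Reasoning

  proper-copies : All ProperBlock Bs → ∀ ws → All ProperBlock (map proj₁ (copies ws Bs))
  proper-copies proper []       = []
  proper-copies proper (w ∷ ws) = subst (All ProperBlock) (sym (List.map-++ proj₁ (withWeight w Bs) (copies ws Bs)))
    (All.++⁺ (subst (All ProperBlock) (sym (blocks-withWeight w Bs)) proper) (proper-copies proper ws))

  values-copies : ∀ {P : ℤ → Set} ws → All P ws → All (P ∘ proj₂) (copies ws Bs)
  values-copies []       []         = []
  values-copies (w ∷ ws) (Pw ∷ Pws) = All.++⁺ (All.map⁺ (universal (λ _ → Pw) Bs)) (values-copies ws Pws)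

  flowAt-copies : ∀ ws x → flowAt (copies ws Bs) x ≡ foldr _+_ 0ℤ ws * flowAt (withWeight 1ℤ Bs) x
  flowAt-copies []       x = refl
  flowAt-copies (w ∷ ws) x = begin
    flowAt (withWeight w Bs ++ copies ws Bs) x                  ≡⟨ flowAt-++ (withWeight w Bs) _ x ⟩
    flowAt (withWeight w Bs) x + flowAt (copies ws Bs) x        ≡⟨ cong₂ _+_ (flowAt-withWeight w Bs x) (flowAt-copies ws x) ⟩
    w * deg + foldr _+_ 0ℤ ws * deg                             ≡⟨ ℤP.*-distribʳ-+ deg w _ ⟨
    (w + foldr _+_ 0ℤ ws) * deg                                 ∎
    where
    open ≡-Reasoning
    deg = flowAt (withWeight 1ℤ Bs) x

copies-withFlow : ∀ {k l} {Bs : List (Block V)} → IsTS V l Bs → ∀ ws →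
              All (FlowValue k) ws → foldr _+_ 0ℤ ws ≡ 0ℤ → HasTSWithFlow k V (length ws ℕ.* l)
copies-withFlow {l = l} {Bs} (proper , pairs) ws values sum≡0 =
  copies ws Bs ,
  (proper-copies Bs proper ws ,
   λ x y x≢y → trans (pairCount-copies Bs ws x y) (cong (length ws ℕ.*_) (pairs x y x≢y))) ,
  (values-copies Bs ws values ,
   λ x → trans (flowAt-copies Bs ws x) (cong (_* flowAt (withWeight 1ℤ Bs) x) sum≡0))

zeroSumFlowValues : ∀ r → 2 ≤ r →
  Σ[ ws ∈ List ℤ ] length ws ≡ r × All (FlowValue 3) ws × foldr _+_ 0ℤ ws ≡ 0ℤ
zeroSumFlowValues 1 (s≤s ())
zeroSumFlowValues 2 _ = 1ℤ ∷ -1ℤ ∷ [] , refl , flowValue 1ℤ ∷ flowValue -1ℤ ∷ [] , refl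
zeroSumFlowValues 3 _ = 1ℤ ∷ 1ℤ ∷ -[1+ 1 ] ∷ [] , refl , flowValue 1ℤ ∷ flowValue 1ℤ ∷ flowValue -[1+ 1 ] ∷ [] , refl
zeroSumFlowValues (suc (suc (suc (suc r)))) _ with zeroSumFlowValues (suc (suc r)) (s≤s (s≤s z≤n))
... | ws , length≡ , values , sum≡0 =
  1ℤ ∷ -1ℤ ∷ ws , cong (ℕ._+_ 2) length≡ , flowValue 1ℤ ∷ flowValue -1ℤ ∷ values ,
  cong (λ t → 1ℤ + (-1ℤ + t)) sum≡0

multiple-withFlow : ∀ {l} {Bs : List (Block V)} → IsTS V l Bs → ∀ r → 2 ≤ r → HasTSWithFlow 3 V (r ℕ.* l)
multiple-withFlow ts r 2≤r with zeroSumFlowValues r 2≤r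
... | ws , refl , values , sum≡0 = copies-withFlow ts ws values sum≡0

properBlock? : ∀ (B : Block V) → Dec (ProperBlock B)
properBlock? (a , b , c) = ¬? (a ≟ b) ×-dec (¬? (a ≟ c) ×-dec ¬? (b ≟ c))

module Grid {r n w : ℕ} (pt : Fin r → Fin n → Fin w)
  (pt-injective : ∀ {i z l a} → pt i z ≡ pt l a → i ≡ l × z ≡ a) where

  pt-≢ˡ : ∀ {i l} → i ≢ l → ∀ z a → pt i z ≢ pt l a
  pt-≢ˡ i≢l z a e = i≢l (proj₁ (pt-injective e))

  pt-≢ʳ : ∀ {z a} → z ≢ a → ∀ i l → pt i z ≢ pt l a
  pt-≢ʳ z≢a i l e = z≢a (proj₂ (pt-injective e))

  δ-pt : ∀ i z l a → δ (pt i z) (pt l a) ≡ δ i l * δ z a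
  δ-pt i z l a with i ≟ l | z ≟ a
  ... | yes refl | yes refl = δ-refl (pt i z)
  ... | yes _    | no z≢a   = δ-≢ (pt-≢ʳ z≢a i l)
  ... | no i≢l   | _        = δ-≢ (pt-≢ˡ i≢l z a)

  ∑∑-δ-pt : ∀ (π : Permutation′ r) (σ : Permutation′ n) i z (g : Fin r → Fin n → ℤ) →
            ∑[ l < r ] ∑[ a < n ] (δ (pt i z) (pt (π ⟨$⟩ʳ l) (σ ⟨$⟩ʳ a)) * g l a) ≡ g (π ⟨$⟩ˡ i) (σ ⟨$⟩ˡ z)
  ∑∑-δ-pt π σ i z g = begin
    ∑[ l < r ] ∑[ a < n ] (δ (pt i z) (pt (π ⟨$⟩ʳ l) (σ ⟨$⟩ʳ a)) * g l a)
      ≡⟨ sum-cong-≗ (λ l → sum-cong-≗ (λ a → split l a)) ⟩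
    ∑[ l < r ] ∑[ a < n ] (δ i (π ⟨$⟩ʳ l) * (δ z (σ ⟨$⟩ʳ a) * g l a))
      ≡⟨ sum-cong-≗ (λ l → *-distribˡ-sum (δ i (π ⟨$⟩ʳ l)) (λ a → δ z (σ ⟨$⟩ʳ a) * g l a)) ⟨
    ∑[ l < r ] (δ i (π ⟨$⟩ʳ l) * ∑[ a < n ] (δ z (σ ⟨$⟩ʳ a) * g l a))
      ≡⟨ sum-cong-≗ (λ l → cong (δ i (π ⟨$⟩ʳ l) *_) (∑-δ-⟨$⟩ʳ σ z (g l))) ⟩
    ∑[ l < r ] (δ i (π ⟨$⟩ʳ l) * g l (σ ⟨$⟩ˡ z))
      ≡⟨ ∑-δ-⟨$⟩ʳ π i (λ l → g l (σ ⟨$⟩ˡ z)) ⟩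
    g (π ⟨$⟩ˡ i) (σ ⟨$⟩ˡ z) ∎
    where
    open ≡-Reasoning
    split : ∀ l a → δ (pt i z) (pt (π ⟨$⟩ʳ l) (σ ⟨$⟩ʳ a)) * g l a ≡ δ i (π ⟨$⟩ʳ l) * (δ z (σ ⟨$⟩ʳ a) * g l a)
    split l a = trans (cong (_* g l a) (δ-pt i z _ _)) (ℤP.*-assoc (δ i _) (δ z _) (g l a))

  -- A family of proper blocks B l a whose corner s is pt (π s ⟨$⟩ʳ l) (σ s ⟨$⟩ʳ a): the translates of a
  -- base block when π and σ are translations.
  module Development (B : Fin r → Fin n → Block w) (π : Fin 3 → Permutation′ r) (σ : Fin 3 → Permutation′ n)
    (proper : ∀ l a → ProperBlock (B l a))
    (shape : ∀ l a s → corner (B l a) s ≡ pt (π s ⟨$⟩ʳ l) (σ s ⟨$⟩ʳ a)) where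

    ∑∑-∑-δ-corner : ∀ i z (g : Fin 3 → Fin r → Fin n → ℤ) →
      ∑[ l < r ] ∑[ a < n ] ∑[ s < 3 ] (δ (pt i z) (corner (B l a) s) * g s l a) ≡ ∑[ s < 3 ] g s (π s ⟨$⟩ˡ i) (σ s ⟨$⟩ˡ z)
    ∑∑-∑-δ-corner i z g = begin
      ∑[ l < r ] ∑[ a < n ] ∑[ s < 3 ] (δ (pt i z) (corner (B l a) s) * g s l a)
        ≡⟨ sum-cong-≗ (λ l → ∑-comm (λ a s → δ (pt i z) (corner (B l a) s) * g s l a)) ⟩
      ∑[ l < r ] ∑[ s < 3 ] ∑[ a < n ] (δ (pt i z) (corner (B l a) s) * g s l a)
        ≡⟨ ∑-comm (λ l s → ∑[ a < n ] (δ (pt i z) (corner (B l a) s) * g s l a)) ⟩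
      ∑[ s < 3 ] ∑[ l < r ] ∑[ a < n ] (δ (pt i z) (corner (B l a) s) * g s l a)
        ≡⟨ sum-cong-≗ (λ s → trans (sum-cong-≗ λ l → sum-cong-≗ λ a → cong (λ p → δ (pt i z) p * g s l a) (shape l a s))
                                   (∑∑-δ-pt (π s) (σ s) i z (g s))) ⟩
      ∑[ s < 3 ] g s (π s ⟨$⟩ˡ i) (σ s ⟨$⟩ˡ z) ∎
      where open ≡-Reasoning

    -- the blocks through pt i z are B (π s ⟨$⟩ˡ i) (σ s ⟨$⟩ˡ z), one for each corner s
    ∑∑-χ : ∀ i z (g : Fin r → Fin n → ℤ) →
           ∑[ l < r ] ∑[ a < n ] (χ (pt i z) (B l a) * g l a) ≡ ∑[ s < 3 ] g (π s ⟨$⟩ˡ i) (σ s ⟨$⟩ˡ z)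
    ∑∑-χ i z g = trans (sum-cong-≗ λ l → sum-cong-≗ λ a → expand l a) (∑∑-∑-δ-corner i z (λ _ → g))
      where
      expand : ∀ l a → χ (pt i z) (B l a) * g l a ≡ ∑[ s < 3 ] (δ (pt i z) (corner (B l a) s) * g l a)
      expand l a = trans (cong (_* g l a) (χ-proper (proper l a) (pt i z)))
                         (*-distribʳ-sum (g l a) (λ s → δ (pt i z) (corner (B l a) s)))

even-or-odd : ∀ d → ∃ λ q → d ≡ q ℕ.+ q ⊎ d ≡ suc (q ℕ.+ q)
even-or-odd zero = 0 , inj₁ refl
even-or-odd (suc d) with even-or-odd d
... | q , inj₁ d≡ = q , inj₂ (cong suc d≡)
... | q , inj₂ d≡ = suc q , inj₁ (cong suc (trans d≡ (sym (ℕP.+-suc q q))))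

even≢odd : ∀ a b → a ℕ.+ a ≢ suc (b ℕ.+ b)
even≢odd zero    b       ()
even≢odd (suc a) zero    e = ℕP.0≢1+n (sym (trans (sym (ℕP.+-suc a a)) (ℕP.suc-injective e)))
even≢odd (suc a) (suc b) e =
  even≢odd a b (ℕP.suc-injective (trans (sym (ℕP.+-suc a a)) (trans (ℕP.suc-injective e) (cong suc (ℕP.+-suc b b)))))

double-injective : ∀ a b → a ℕ.+ a ≡ b ℕ.+ b → a ≡ b
double-injective zero    zero    _ = refl
double-injective (suc a) (suc b) e =
  cong suc (double-injective a b (ℕP.suc-injective (trans (sym (ℕP.+-suc a a)) (trans (ℕP.suc-injective e) (ℕP.+-suc b b)))))

double-cancel-≤ : ∀ {p q} → p ℕ.+ p ≤ q ℕ.+ q → p ≤ q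
double-cancel-≤ 2p≤2q = ℕP.≮⇒≥ (λ q<p → ℕP.<⇒≱ (ℕP.+-mono-< q<p q<p) 2p≤2q)

module Bose (m : ℕ) where

  n : ℕ
  n = suc (m ℕ.+ m)

  offset : Fin m → ℕ
  offset t = suc (toℕ t)

  double-offset : Fin m → ℕ
  double-offset t = offset t ℕ.+ offset t

  offset-injective : ∀ {t u} → offset t ≡ offset u → t ≡ u
  offset-injective e = Fin.toℕ-injective (ℕP.suc-injective e)

  double-offset-injective : ∀ {t u} → double-offset t ≡ double-offset u → t ≡ u
  double-offset-injective {t} {u} e = offset-injective (double-injective (offset t) (offset u) e)

  offset<n : ∀ t → offset t < n
  offset<n t = s≤s (ℕP.≤-trans (Fin.toℕ<n t) (ℕP.m≤m+n m m))

  double-offset<n : ∀ t → double-offset t < n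
  double-offset<n t = s≤s (ℕP.+-mono-≤ (Fin.toℕ<n t) (Fin.toℕ<n t))

  private
    ∑-𝟙-offset : ∀ {y} → 1 ≤ y → y ≤ m → ∑[ t < m ] 𝟙 (y ℕP.≟ offset t) ≡ 1ℤ
    ∑-𝟙-offset {suc q} _ q<m =
      ∑-𝟙-image ℕP._≟_ offset offset-injective (fromℕ< q<m) (cong suc (sym (Fin.toℕ-fromℕ< q<m)))

    ∑-𝟙-offset-∉ : ∀ {y} → m < y → ∑[ t < m ] 𝟙 (y ℕP.≟ offset t) ≡ 0ℤ
    ∑-𝟙-offset-∉ m<y = ∑-𝟙-∉ ℕP._≟_ offset (λ t y≡ → ℕP.<-irrefl (sym y≡) (ℕP.≤-<-trans (Fin.toℕ<n t) m<y))

    ∑-𝟙-double-offset : ∀ {q} → 1 ≤ q → q ≤ m → ∑[ t < m ] 𝟙 (q ℕ.+ q ℕP.≟ double-offset t) ≡ 1ℤ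
    ∑-𝟙-double-offset {suc q} _ q<m = ∑-𝟙-image ℕP._≟_ double-offset double-offset-injective
      (fromℕ< q<m) (cong (λ p → suc p ℕ.+ suc p) (sym (Fin.toℕ-fromℕ< q<m)))

    ∑-𝟙-double-offset-odd : ∀ q → ∑[ t < m ] 𝟙 (suc (q ℕ.+ q) ℕP.≟ double-offset t) ≡ 0ℤ
    ∑-𝟙-double-offset-odd q = ∑-𝟙-∉ ℕP._≟_ double-offset (λ t e → even≢odd (offset t) q (sym e))

  complementary-offset : ∀ {d d′} → 1 ≤ d → 1 ≤ d′ → d ℕ.+ d′ ≡ n →
    ∑[ t < m ] (𝟙 (d ℕP.≟ offset t) + 𝟙 (d′ ℕP.≟ offset t)) ≡ 1ℤ
  complementary-offset {d} {d′} 1≤d 1≤d′ d+d′≡n =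
    trans (∑-distrib-+ (λ t → 𝟙 (d ℕP.≟ offset t)) (λ t → 𝟙 (d′ ℕP.≟ offset t))) (by-size (d ℕP.≤? m))
    where
    too-small : d ≤ m → d′ ≤ m → ⊥
    too-small d≤m d′≤m = ℕP.<-irrefl d+d′≡n (s≤s (ℕP.+-mono-≤ d≤m d′≤m))
    too-big : m < d → m < d′ → ⊥
    too-big m<d m<d′ = ℕP.<-irrefl (sym d+d′≡n) (ℕP.+-mono-≤-< m<d m<d′)
    by-size : Dec (d ≤ m) → ∑[ t < m ] 𝟙 (d ℕP.≟ offset t) + ∑[ t < m ] 𝟙 (d′ ℕP.≟ offset t) ≡ 1ℤ
    by-size (yes d≤m) = cong₂ _+_ (∑-𝟙-offset 1≤d d≤m) (∑-𝟙-offset-∉ (ℕP.≰⇒> (too-small d≤m)))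
    by-size (no d≰m)  = cong₂ _+_ (∑-𝟙-offset-∉ (ℕP.≰⇒> d≰m)) (∑-𝟙-offset 1≤d′ (ℕP.≮⇒≥ (too-big (ℕP.≰⇒> d≰m))))

  private
    half-bound : ∀ {q d′} → 1 ≤ d′ → q ℕ.+ q ℕ.+ d′ ≡ n → q ≤ m
    half-bound {q} 1≤d′ sum≡n =
      double-cancel-≤ (ℕP.≤-pred (subst₂ _≤_ (ℕP.+-comm (q ℕ.+ q) 1) sum≡n (ℕP.+-monoʳ-≤ (q ℕ.+ q) 1≤d′)))

    half-positive : ∀ {q} → 1 ≤ q ℕ.+ q → 1 ≤ q
    half-positive {suc q} _ = s≤s z≤n

    not-both-even : ∀ q p → q ℕ.+ q ℕ.+ (p ℕ.+ p) ≢ n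
    not-both-even q p e = even≢odd (q ℕ.+ p) m (trans (shuffle q p) e)
      where shuffle : ∀ q p → q ℕ.+ p ℕ.+ (q ℕ.+ p) ≡ q ℕ.+ q ℕ.+ (p ℕ.+ p)
            shuffle = ℕ-Solver.solve-∀

    not-both-odd : ∀ q p → suc (q ℕ.+ q) ℕ.+ suc (p ℕ.+ p) ≢ n
    not-both-odd q p e = even≢odd (suc (q ℕ.+ p)) m (trans (shuffle q p) e)
      where shuffle : ∀ q p → suc (q ℕ.+ p) ℕ.+ suc (q ℕ.+ p) ≡ suc (q ℕ.+ q) ℕ.+ suc (p ℕ.+ p)
            shuffle = ℕ-Solver.solve-∀

  -- one of d and d′ is even since n is odd
  complementary-double-offset : ∀ {d d′} → 1 ≤ d → 1 ≤ d′ → d ℕ.+ d′ ≡ n →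
    ∑[ t < m ] (𝟙 (d ℕP.≟ double-offset t) + 𝟙 (d′ ℕP.≟ double-offset t)) ≡ 1ℤ
  complementary-double-offset {d} {d′} 1≤d 1≤d′ d+d′≡n =
    trans (∑-distrib-+ (λ t → 𝟙 (d ℕP.≟ double-offset t)) (λ t → 𝟙 (d′ ℕP.≟ double-offset t)))
          (by-parity (even-or-odd d) (even-or-odd d′))
    where
    by-parity : ∃ (λ q → d ≡ q ℕ.+ q ⊎ d ≡ suc (q ℕ.+ q)) → ∃ (λ p → d′ ≡ p ℕ.+ p ⊎ d′ ≡ suc (p ℕ.+ p)) →
                ∑[ t < m ] 𝟙 (d ℕP.≟ double-offset t) + ∑[ t < m ] 𝟙 (d′ ℕP.≟ double-offset t) ≡ 1ℤ
    by-parity (q , inj₁ refl) (p , inj₁ refl) = ⊥-elim (not-both-even q p d+d′≡n)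
    by-parity (q , inj₁ refl) (p , inj₂ refl) =
      cong₂ _+_ (∑-𝟙-double-offset {q} (half-positive 1≤d) (half-bound 1≤d′ d+d′≡n)) (∑-𝟙-double-offset-odd p)
    by-parity (q , inj₂ refl) (p , inj₁ refl) =
      cong₂ _+_ (∑-𝟙-double-offset-odd q)
                (∑-𝟙-double-offset {p} (half-positive 1≤d′) (half-bound 1≤d (trans (ℕP.+-comm (p ℕ.+ p) d) d+d′≡n)))
    by-parity (q , inj₂ refl) (p , inj₂ refl) = ⊥-elim (not-both-odd q p d+d′≡n)

  open Cyclic n
  open Cyclic 3 using () renaming (_⊕_ to _⊕₃_; _⊖_ to _⊖₃_; ⊖-⊕ to ⊖₃-⊕₃; rotation to rotation₃)

  δ-⊕ : ∀ {k} → k < n → ∀ w z → δ w (z ⊕ k) ≡ 𝟙 (diff w z ℕP.≟ k)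
  δ-⊕ {k} k<n w z = 𝟙-⇔ (≡⊕⇒diff {w} {z} k<n) (diff⇒≡⊕ {w} {z}) (w ≟ z ⊕ k) (diff w z ℕP.≟ k)

  δ-⊖ : ∀ {k} → k < n → ∀ w z → δ w (z ⊖ k) ≡ 𝟙 (diff z w ℕP.≟ k)
  δ-⊖ {k} k<n w z = 𝟙-⇔ (λ w≡ → ≡⊕⇒diff {z} {w} k<n (trans (sym (⊖-⊕ z k)) (cong (_⊕ k) (sym w≡))))
                       (λ d≡k → trans (sym (⊕-⊖ w k)) (cong (_⊖ k) (sym (diff⇒≡⊕ {z} {w} d≡k))))
                       (w ≟ z ⊖ k) (diff z w ℕP.≟ k)

  shifts : Fin n → Fin n → ℕ → ℤ
  shifts w z k = δ w (z ⊕ k) + δ w (z ⊖ k)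

  ∑-shifts-offset : ∀ {w z} → w ≢ z → ∑[ t < m ] shifts w z (offset t) ≡ 1ℤ
  ∑-shifts-offset {w} {z} w≢z =
    trans (sum-cong-≗ (λ t → cong₂ _+_ (δ-⊕ (offset<n t) w z) (δ-⊖ (offset<n t) w z)))
          (complementary-offset (diff-positive w≢z) (diff-positive (w≢z ∘ sym)) (diff-+-diff w≢z))

  ∑-shifts-double-offset : ∀ {w z} → w ≢ z → ∑[ t < m ] shifts w z (double-offset t) ≡ 1ℤ
  ∑-shifts-double-offset {w} {z} w≢z =
    trans (sum-cong-≗ (λ t → cong₂ _+_ (δ-⊕ (double-offset<n t) w z) (δ-⊖ (double-offset<n t) w z)))
          (complementary-double-offset (diff-positive w≢z) (diff-positive (w≢z ∘ sym)) (diff-+-diff w≢z))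

  shifts-self : ∀ {k} → 1 ≤ k → k < n → ∀ z → shifts z z k ≡ 0ℤ
  shifts-self {suc k} _ k<n z =
    cong₂ _+_ (trans (δ-⊕ k<n z z) (not-zero (diff-self z))) (trans (δ-⊖ k<n z z) (not-zero (diff-self z)))
    where
    not-zero : ∀ {d} → d ≡ 0 → 𝟙 (d ℕP.≟ suc k) ≡ 0ℤ
    not-zero refl = refl

  next-level-≢ : ∀ l → l ≢ l ⊕₃ 1
  next-level-≢ 0F ()
  next-level-≢ 1F ()
  next-level-≢ 2F ()

  δ-levels : ∀ i j → δ j i + (δ j (i ⊕₃ 1) + δ j (i ⊖₃ 1)) ≡ 1ℤ
  δ-levels 0F 0F = refl
  δ-levels 0F 1F = refl
  δ-levels 0F 2F = refl
  δ-levels 1F 0F = refl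
  δ-levels 1F 1F = refl
  δ-levels 1F 2F = refl
  δ-levels 2F 0F = refl
  δ-levels 2F 1F = refl
  δ-levels 2F 2F = refl

  -- the weight on residue z of the offset-t triangles when the one at (l, a) weighs wt t a
  weightThrough : (Fin m → Fin n → ℤ) → Fin m → Fin n → ℤ
  weightThrough wt t z = wt t z + (wt t (z ⊖ double-offset t) + (wt t (z ⊖ offset t) + 0ℤ))

  -- the pairs {(i, z), (j, w)} covered by the offset-t triangles; (i, z) = (j, w) is counted thrice
  trianglePairs : Fin m → Fin 3 → Fin n → Fin 3 → Fin n → ℤ
  trianglePairs t i z j w = + 3 * (δ j i * δ w z) + δ j i * shifts w z (double-offset t)
                            + (δ j (i ⊕₃ 1) + δ j (i ⊖₃ 1)) * shifts w z (offset t)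

  ∑-trianglePairs-distinct : ∀ i z j {w} → w ≢ z → ∑[ t < m ] trianglePairs t i z j w ≡ 1ℤ
  ∑-trianglePairs-distinct i z j {w} w≢z = begin
    ∑[ t < m ] trianglePairs t i z j w
      ≡⟨ sum-cong-≗ (λ t → off-diagonal (shifts w z (double-offset t)) (shifts w z (offset t))) ⟩
    ∑[ t < m ] (δ j i * shifts w z (double-offset t) + L * shifts w z (offset t))
      ≡⟨ ∑-distrib-+ (λ t → δ j i * shifts w z (double-offset t)) (λ t → L * shifts w z (offset t)) ⟩
    ∑[ t < m ] (δ j i * shifts w z (double-offset t)) + ∑[ t < m ] (L * shifts w z (offset t))
      ≡⟨ cong₂ _+_ (*-distribˡ-sum (δ j i) (shifts w z ∘ double-offset)) (*-distribˡ-sum L (shifts w z ∘ offset)) ⟨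
    δ j i * ∑[ t < m ] shifts w z (double-offset t) + L * ∑[ t < m ] shifts w z (offset t)
      ≡⟨ cong₂ (λ p q → δ j i * p + L * q) (∑-shifts-double-offset w≢z) (∑-shifts-offset w≢z) ⟩
    δ j i * 1ℤ + L * 1ℤ
      ≡⟨ cong₂ _+_ (ℤP.*-identityʳ (δ j i)) (ℤP.*-identityʳ L) ⟩
    δ j i + L
      ≡⟨ δ-levels i j ⟩
    1ℤ ∎
    where
    open ≡-Reasoning
    L = δ j (i ⊕₃ 1) + δ j (i ⊖₃ 1)
    off-diagonal : ∀ p q → + 3 * (δ j i * δ w z) + δ j i * p + L * q ≡ δ j i * p + L * q
    off-diagonal p q = trans (cong (λ d → + 3 * (δ j i * d) + δ j i * p + L * q) (δ-≢ w≢z)) (drop (δ j i) p L q)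
      where drop : ∀ a p l q → + 3 * (a * 0ℤ) + a * p + l * q ≡ a * p + l * q
            drop = solve-∀

  ∑-trianglePairs-same-residue : ∀ {i j} z → j ≢ i → ∑[ t < m ] trianglePairs t i z j z ≡ 0ℤ
  ∑-trianglePairs-same-residue {i} {j} z j≢i = trans (sum-cong-≗ vanish) (sum-replicate-zero m)
    where
    vanish : ∀ t → trianglePairs t i z j z ≡ 0ℤ
    vanish t = zeros (δ-≢ j≢i) (shifts-self (s≤s z≤n) (double-offset<n t) z) (shifts-self (s≤s z≤n) (offset<n t) z)
      where
      zeros : ∀ {a p q} → a ≡ 0ℤ → p ≡ 0ℤ → q ≡ 0ℤ →
              + 3 * (a * δ z z) + a * p + (δ j (i ⊕₃ 1) + δ j (i ⊖₃ 1)) * q ≡ 0ℤ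
      zeros refl refl refl = vanishing (δ z z) (δ j (i ⊕₃ 1) + δ j (i ⊖₃ 1))
        where vanishing : ∀ b l → + 3 * (0ℤ * b) + 0ℤ * 0ℤ + l * 0ℤ ≡ 0ℤ
              vanishing = solve-∀

  module Steiner {w : ℕ} (pt : Fin 3 → Fin n → Fin w)
                 (pt-injective : ∀ {i z l a} → pt i z ≡ pt l a → i ≡ l × z ≡ a) where

    open Grid pt pt-injective

    triangle : Fin m → Fin 3 → Fin n → Block w
    triangle t l a = pt l a , pt l (a ⊕ double-offset t) , pt (l ⊕₃ 1) (a ⊕ offset t)

    vertical : Fin n → Block w
    vertical a = pt 0F a , pt 1F a , pt 2F a

    triangles : Fin m → List (Block w)
    triangles t = ⋃[ l < 3 ] ⋃[ a < n ] [ triangle t l a ]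

    verticals : List (Block w)
    verticals = ⋃[ a < n ] [ vertical a ]

    steinerBlocks : List (Block w)
    steinerBlocks = (⋃[ t < m ] triangles t) ++ verticals

    proper-triangle : ∀ t l a → ProperBlock (triangle t l a)
    proper-triangle t l a = pt-≢ʳ shifted l l , pt-≢ˡ (next-level-≢ l) a _ , pt-≢ˡ (next-level-≢ l) (a ⊕ double-offset t) _
      where
      shifted : a ≢ a ⊕ double-offset t
      shifted e = ℕP.0≢1+n (trans (sym (diff-self a)) (≡⊕⇒diff {a} {a} (double-offset<n t) e))

    proper-vertical : ∀ a → ProperBlock (vertical a)
    proper-vertical a = pt-≢ˡ (λ ()) a a , pt-≢ˡ (λ ()) a a , pt-≢ˡ (λ ()) a a

    triangle-levels : Fin 3 → Permutation′ 3
    triangle-levels 2F = rotation₃ 1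
    triangle-levels _  = Perm.id

    triangle-residues : Fin m → Fin 3 → Permutation′ n
    triangle-residues t 0F = Perm.id
    triangle-residues t 1F = rotation (double-offset t)
    triangle-residues t 2F = rotation (offset t)

    triangle-shape : ∀ t l a s → corner (triangle t l a) s ≡ pt (triangle-levels s ⟨$⟩ʳ l) (triangle-residues t s ⟨$⟩ʳ a)
    triangle-shape t l a 0F = refl
    triangle-shape t l a 1F = refl
    triangle-shape t l a 2F = refl

    module Triangles (t : Fin m) = Development (triangle t) triangle-levels (triangle-residues t) (proper-triangle t) (triangle-shape t)

    ∑∑-δ-corner-1 : ∀ t s i z → ∑[ l < 3 ] ∑[ a < n ] δ (pt i z) (corner (triangle t l a) s) ≡ 1ℤ
    ∑∑-δ-corner-1 t s i z = trans (sum-cong-≗ λ l → sum-cong-≗ λ a →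
        trans (cong (δ (pt i z)) (triangle-shape t l a s)) (sym (ℤP.*-identityʳ _)))
      (∑∑-δ-pt (triangle-levels s) (triangle-residues t s) i z (λ _ _ → 1ℤ))

    ∑∑-χ-triangle : ∀ t i z (g : Fin 3 → Fin n → ℤ) →
      ∑[ l < 3 ] ∑[ a < n ] (χ (pt i z) (triangle t l a) * g l a) ≡
      g i z + (g i (z ⊖ double-offset t) + (g (i ⊖₃ 1) (z ⊖ offset t) + 0ℤ))
    ∑∑-χ-triangle t = Triangles.∑∑-χ t

    χ-triangle : ∀ t l a j w → χ (pt j w) (triangle t l a) ≡
      δ j l * δ w a + (δ j l * δ w (a ⊕ double-offset t) + (δ j (l ⊕₃ 1) * δ w (a ⊕ offset t) + 0ℤ))
    χ-triangle t l a j w = trans (χ-proper (proper-triangle t l a) (pt j w))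
      (cong₂ _+_ (δ-pt j w l a) (cong₂ _+_ (δ-pt j w l _) (cong (_+ 0ℤ) (δ-pt j w _ _))))

    pairs-triangles : ∀ t i z j w → pairCountℤ (triangles t) (pt i z) (pt j w) ≡ trianglePairs t i z j w
    pairs-triangles t i z j w = begin
      pairCountℤ (triangles t) x y
        ≡⟨ pairCount-⋃ (λ l → ⋃[ a < n ] [ triangle t l a ]) x y ⟩
      ∑[ l < 3 ] pairCountℤ (⋃[ a < n ] [ triangle t l a ]) x y
        ≡⟨ sum-cong-≗ (λ l → trans (pairCount-⋃ (λ a → [ triangle t l a ]) x y) (sum-cong-≗ (λ a → pairCount-[ triangle t l a ] x y))) ⟩
      ∑[ l < 3 ] ∑[ a < n ] (χ x (triangle t l a) * χ y (triangle t l a))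
        ≡⟨ ∑∑-χ-triangle t i z (λ l a → χ y (triangle t l a)) ⟩
      χ y (triangle t i z) + (χ y (triangle t i (z ⊖ 2k)) + (χ y (triangle t (i ⊖₃ 1) (z ⊖ k)) + 0ℤ))
        ≡⟨ cong₂ _+_ (χ-triangle t i z j w) (cong₂ _+_ second (cong (_+ 0ℤ) third)) ⟩
      (δ j i * δ w z + (δ j i * δ w (z ⊕ 2k) + (δ j (i ⊕₃ 1) * δ w (z ⊕ k) + 0ℤ))) +
      ((δ j i * δ w (z ⊖ 2k) + (δ j i * δ w z + (δ j (i ⊕₃ 1) * δ w (z ⊖ k) + 0ℤ))) +
       ((δ j (i ⊖₃ 1) * δ w (z ⊖ k) + (δ j (i ⊖₃ 1) * δ w (z ⊕ k) + (δ j i * δ w z + 0ℤ))) + 0ℤ))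
        ≡⟨ collect (δ j i) (δ w z) (δ w (z ⊕ 2k)) (δ w (z ⊖ 2k)) (δ j (i ⊕₃ 1)) (δ j (i ⊖₃ 1)) (δ w (z ⊕ k)) (δ w (z ⊖ k)) ⟩
      trianglePairs t i z j w ∎
      where
      open ≡-Reasoning
      x = pt i z
      y = pt j w
      k = offset t
      2k = double-offset t
      second : χ y (triangle t i (z ⊖ 2k)) ≡ δ j i * δ w (z ⊖ 2k) + (δ j i * δ w z + (δ j (i ⊕₃ 1) * δ w (z ⊖ k) + 0ℤ))
      second = trans (χ-triangle t i (z ⊖ 2k) j w)
        (cong (λ p → δ j i * δ w (z ⊖ 2k) + p)
              (cong₂ (λ a b → δ j i * δ w a + (δ j (i ⊕₃ 1) * δ w b + 0ℤ)) (⊖-⊕ z 2k) (⊖[+]-⊕ z k k)))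
      third : χ y (triangle t (i ⊖₃ 1) (z ⊖ k)) ≡
              δ j (i ⊖₃ 1) * δ w (z ⊖ k) + (δ j (i ⊖₃ 1) * δ w (z ⊕ k) + (δ j i * δ w z + 0ℤ))
      third = trans (χ-triangle t (i ⊖₃ 1) (z ⊖ k) j w)
        (cong (λ p → δ j (i ⊖₃ 1) * δ w (z ⊖ k) + p)
          (cong₂ (λ a p → δ j (i ⊖₃ 1) * δ w a + p) (⊖-⊕[+] z k k)
                 (cong₂ (λ l a → δ j l * δ w a + 0ℤ) (⊖₃-⊕₃ i 1) (⊖-⊕ z k))))
      collect : ∀ a b p q r u s t′ →
        (a * b + (a * p + (r * s + 0ℤ))) + ((a * q + (a * b + (r * t′ + 0ℤ))) + ((u * t′ + (u * s + (a * b + 0ℤ))) + 0ℤ)) ≡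
        + 3 * (a * b) + a * (p + q) + (r + u) * (s + t′)
      collect = solve-∀

    vertical-corner : ∀ a s → corner (vertical a) s ≡ pt s a
    vertical-corner a 0F = refl
    vertical-corner a 1F = refl
    vertical-corner a 2F = refl

    χ-vertical : ∀ i z a → χ (pt i z) (vertical a) ≡ δ z a
    χ-vertical i z a = begin
      χ (pt i z) (vertical a)                         ≡⟨ χ-proper (proper-vertical a) (pt i z) ⟩
      ∑[ s < 3 ] δ (pt i z) (corner (vertical a) s)   ≡⟨ sum-cong-≗ (λ s → trans (cong (δ (pt i z)) (vertical-corner a s))
                                                                                  (δ-pt i z s a)) ⟩
      ∑[ s < 3 ] (δ i s * δ z a)                      ≡⟨ *-distribʳ-sum (δ z a) (δ i) ⟨
      ∑[ s < 3 ] δ i s * δ z a                        ≡⟨ cong (_* δ z a) (∑-δ-1 i) ⟩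
      1ℤ * δ z a                                      ≡⟨ ℤP.*-identityˡ (δ z a) ⟩
      δ z a                                           ∎
      where open ≡-Reasoning

    ∑-χ-vertical : ∀ i z (g : Fin n → ℤ) → ∑[ a < n ] (χ (pt i z) (vertical a) * g a) ≡ g z
    ∑-χ-vertical i z g = trans (sum-cong-≗ (λ a → cong (_* g a) (χ-vertical i z a))) (∑-δ z g)

    pairs-verticals : ∀ i z j w → pairCountℤ verticals (pt i z) (pt j w) ≡ δ w z
    pairs-verticals i z j w = begin
      pairCountℤ verticals (pt i z) (pt j w)
        ≡⟨ pairCount-⋃ (λ a → [ vertical a ]) (pt i z) (pt j w) ⟩
      ∑[ a < n ] pairCountℤ [ vertical a ] (pt i z) (pt j w)
        ≡⟨ sum-cong-≗ (λ a → trans (pairCount-[ vertical a ] (pt i z) (pt j w)) (cong (χ (pt i z) (vertical a) *_) (χ-vertical j w a))) ⟩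
      ∑[ a < n ] (χ (pt i z) (vertical a) * δ w a)
        ≡⟨ ∑-χ-vertical i z (δ w) ⟩
      δ w z ∎
      where open ≡-Reasoning

    steiner-pairs : ∀ i z j w → pt i z ≢ pt j w → pairCountℤ steinerBlocks (pt i z) (pt j w) ≡ 1ℤ
    steiner-pairs i z j w x≢y = begin
      pairCountℤ steinerBlocks x y
        ≡⟨ pairCountℤ-++ (⋃[ t < m ] triangles t) verticals x y ⟩
      pairCountℤ (⋃[ t < m ] triangles t) x y + pairCountℤ verticals x y
        ≡⟨ cong₂ _+_ (trans (pairCount-⋃ triangles x y) (sum-cong-≗ (λ t → pairs-triangles t i z j w))) (pairs-verticals i z j w) ⟩
      ∑[ t < m ] trianglePairs t i z j w + δ w z
        ≡⟨ by-residue (w ≟ z) ⟩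
      1ℤ ∎
      where
      open ≡-Reasoning
      x = pt i z
      y = pt j w
      by-residue : Dec (w ≡ z) → ∑[ t < m ] trianglePairs t i z j w + δ w z ≡ 1ℤ
      by-residue (yes refl) = cong₂ _+_ (∑-trianglePairs-same-residue z (λ j≡i → x≢y (cong₂ pt (sym j≡i) refl))) (δ-refl z)
      by-residue (no w≢z)  = trans (cong₂ _+_ (∑-trianglePairs-distinct i z j w≢z) (δ-≢ w≢z)) (ℤP.+-identityʳ 1ℤ)

    weightedTriangles : (Fin m → Fin n → ℤ) → Fin m → List (Block w × ℤ)
    weightedTriangles wt t = ⋃[ l < 3 ] ⋃[ a < n ] [ (triangle t l a , wt t a) ]

    weightedVerticals : (Fin n → ℤ) → List (Block w × ℤ)
    weightedVerticals u = ⋃[ a < n ] [ (vertical a , u a) ]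

    weighted : (Fin m → Fin n → ℤ) → (Fin n → ℤ) → List (Block w × ℤ)
    weighted wt u = (⋃[ t < m ] weightedTriangles wt t) ++ weightedVerticals u

    blocks-weighted : ∀ wt u → map proj₁ (weighted wt u) ≡ steinerBlocks
    blocks-weighted wt u = trans (List.map-++ proj₁ (⋃[ t < m ] weightedTriangles wt t) (weightedVerticals u))
      (cong₂ _++_ (trans (map-⋃ proj₁ (weightedTriangles wt)) (⋃-cong λ t →
                     trans (map-⋃ proj₁ (λ l → ⋃[ a < n ] [ (triangle t l a , wt t a) ])) (⋃-cong λ l →
                       map-⋃ proj₁ (λ a → [ (triangle t l a , wt t a) ]))))
                  (map-⋃ proj₁ (λ a → [ (vertical a , u a) ])))

    values-weighted : ∀ {P : ℤ → Set} wt u → (∀ t a → P (wt t a)) → (∀ a → P (u a)) → All (P ∘ proj₂) (weighted wt u)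
    values-weighted wt u P-wt P-u =
      All.++⁺ (All-⋃ (weightedTriangles wt) λ t →
                 All-⋃ (λ l → ⋃[ a < n ] [ (triangle t l a , wt t a) ]) λ l →
                   All-⋃ (λ a → [ (triangle t l a , wt t a) ]) λ a → P-wt t a ∷ [])
              (All-⋃ (λ a → [ (vertical a , u a) ]) λ a → P-u a ∷ [])

    flowAt-weightedTriangles : ∀ wt t i z → flowAt (weightedTriangles wt t) (pt i z) ≡ weightThrough wt t z
    flowAt-weightedTriangles wt t i z = begin
      flowAt (weightedTriangles wt t) (pt i z)
        ≡⟨ flowAt-⋃ (λ l → ⋃[ a < n ] [ (triangle t l a , wt t a) ]) (pt i z) ⟩
      ∑[ l < 3 ] flowAt (⋃[ a < n ] [ (triangle t l a , wt t a) ]) (pt i z)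
        ≡⟨ sum-cong-≗ (λ l → trans (flowAt-⋃ (λ a → [ (triangle t l a , wt t a) ]) (pt i z))
                                   (sum-cong-≗ (λ a → flowAt-[ triangle t l a , wt t a ] (pt i z)))) ⟩
      ∑[ l < 3 ] ∑[ a < n ] (χ (pt i z) (triangle t l a) * wt t a)
        ≡⟨ ∑∑-χ-triangle t i z (λ _ a → wt t a) ⟩
      weightThrough wt t z ∎
      where open ≡-Reasoning

    flowAt-weighted : ∀ wt u i z → flowAt (weighted wt u) (pt i z) ≡ ∑[ t < m ] weightThrough wt t z + u z
    flowAt-weighted wt u i z = begin
      flowAt (weighted wt u) x
        ≡⟨ flowAt-++ (⋃[ t < m ] weightedTriangles wt t) (weightedVerticals u) x ⟩
      flowAt (⋃[ t < m ] weightedTriangles wt t) x + flowAt (weightedVerticals u) x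
        ≡⟨ cong₂ _+_ (trans (flowAt-⋃ (weightedTriangles wt) x) (sum-cong-≗ λ t → flowAt-weightedTriangles wt t i z))
                     (trans (flowAt-⋃ (λ a → [ (vertical a , u a) ]) x) (sum-cong-≗ (λ a → flowAt-[ vertical a , u a ] x))) ⟩
      ∑[ t < m ] weightThrough wt t z + ∑[ a < n ] (χ x (vertical a) * u a)
        ≡⟨ cong (_+_ (∑[ t < m ] weightThrough wt t z)) (∑-χ-vertical i z u) ⟩
      ∑[ t < m ] weightThrough wt t z + u z ∎
      where
      open ≡-Reasoning
      x = pt i z

    All-triangles : ∀ {P : Block w → Set} t → (∀ l a → P (triangle t l a)) → All P (triangles t)
    All-triangles t P-triangle =
      All-⋃ (λ l → ⋃[ a < n ] [ triangle t l a ]) λ l → All-⋃ (λ a → [ triangle t l a ]) λ a → P-triangle l a ∷ []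

    All-verticals : ∀ {P : Block w → Set} → (∀ a → P (vertical a)) → All P verticals
    All-verticals P-vertical = All-⋃ (λ a → [ vertical a ]) λ a → P-vertical a ∷ []

    proper-steinerBlocks : All ProperBlock steinerBlocks
    proper-steinerBlocks = All.++⁺ (All-⋃ triangles λ t → All-triangles t (proper-triangle t)) (All-verticals proper-vertical)

  module System = Steiner combine (λ {i} {z} {l} {a} → Fin.combine-injective i z l a)

  steinerTripleSystem : IsTS (3 ℕ.* n) 1 System.steinerBlocks
  steinerTripleSystem = System.proper-steinerBlocks , pairs
    where
    pairs : ∀ x y → x ≢ y → pairCount System.steinerBlocks x y ≡ 1
    pairs x y x≢y with Fin.combine-surjective {m = 3} {n = n} x | Fin.combine-surjective {m = 3} {n = n} y
    ... | i , z , refl | j , w , refl = ℤP.+-injective (System.steiner-pairs i z j w x≢y)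

multipleOf3 : ℕ → ℤ
multipleOf3 0                   = 1ℤ
multipleOf3 1                   = 0ℤ
multipleOf3 2                   = 0ℤ
multipleOf3 (suc (suc (suc a))) = multipleOf3 a

multipleOf3-01 : ∀ a → multipleOf3 a ≡ 0ℤ ⊎ multipleOf3 a ≡ 1ℤ
multipleOf3-01 0                   = inj₂ refl
multipleOf3-01 1                   = inj₁ refl
multipleOf3-01 2                   = inj₁ refl
multipleOf3-01 (suc (suc (suc a))) = multipleOf3-01 a

multipleOf3-consecutive : ∀ a → multipleOf3 a + (multipleOf3 (suc a) + multipleOf3 (suc (suc a))) ≡ 1ℤ
multipleOf3-consecutive 0                   = refl
multipleOf3-consecutive 1                   = refl
multipleOf3-consecutive 2                   = refl
multipleOf3-consecutive (suc (suc (suc a))) = multipleOf3-consecutive a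

alternating : ℕ → ℤ
alternating 0             = -1ℤ
alternating 1             = 1ℤ
alternating (suc (suc j)) = alternating j

alternating-values : ∀ j → alternating j ≡ -1ℤ ⊎ alternating j ≡ 1ℤ
alternating-values 0             = inj₁ refl
alternating-values 1             = inj₂ refl
alternating-values (suc (suc j)) = alternating-values j

scale : ℕ → ℤ
scale 0             = -[1+ 1 ]
scale 1             = 1ℤ
scale (suc (suc q)) = scale q

scale-values : ∀ q → scale q ≡ -[1+ 1 ] ⊎ scale q ≡ 1ℤ
scale-values 0             = inj₁ refl
scale-values 1             = inj₂ refl
scale-values (suc (suc q)) = scale-values q

triple : ℤ → ℤ
triple x = x + (x + (x + 0ℤ))

-- scale q compensates 3·(-1 + 1 - 1 + ⋯), the weight that q further offsets of alternating weight put on a point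
vertical-value : ∀ q c → c ≡ 1ℤ ⊎ c ≡ + 2 → FlowValue 3 (- (+ 3 + scale q * c + ∑[ j < q ] triple (alternating (toℕ j))))
vertical-value 0 c (inj₁ refl) = flowValue -1ℤ
vertical-value 0 c (inj₂ refl) = flowValue 1ℤ
vertical-value 1 c (inj₁ refl) = flowValue -1ℤ
vertical-value 1 c (inj₂ refl) = flowValue -[1+ 1 ]
vertical-value (suc (suc q)) c c≡ =
  subst (FlowValue 3) (cong -_ (periodic (+ 3 + scale q * c) (∑[ j < q ] triple (alternating (toℕ j))))) (vertical-value q c c≡)
  where
  periodic : ∀ a s → a + s ≡ a + (triple -1ℤ + (triple 1ℤ + s))
  periodic = solve-∀

module BoseFlow (m′ : ℕ) where

  open Bose (suc m′)
  open Cyclic n using (_⊖_; toℕ-⊖; toℕ-⊖-wrap)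

  -- the multiples of 3 among z - 2, z - 1, z, each read as a number in [0, n)
  window : Fin n → ℤ
  window z = multipleOf3 (toℕ z) + (multipleOf3 (toℕ (z ⊖ 2)) + multipleOf3 (toℕ (z ⊖ 1)))

  -- there are two only if the window wraps around
  window-1or2 : ∀ z → window z ≡ 1ℤ ⊎ window z ≡ + 2
  window-1or2 0F = by-last (multipleOf3-01 (suc (suc a)))
    where
    a = m′ ℕ.+ suc m′
    wrapped : window 0F ≡ 1ℤ + (multipleOf3 a + multipleOf3 (suc a))
    wrapped = cong₂ (λ p q → 1ℤ + (multipleOf3 p + multipleOf3 q)) (toℕ-⊖-wrap 0F (s≤s z≤n) (s≤s (s≤s z≤n)))
                                                                   (toℕ-⊖-wrap 0F (s≤s z≤n) (s≤s z≤n))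
    first-two : 1ℤ + (multipleOf3 a + multipleOf3 (suc a)) ≡ 1ℤ + (1ℤ - multipleOf3 (suc (suc a)))
    first-two = trans (split (multipleOf3 a) (multipleOf3 (suc a)) (multipleOf3 (suc (suc a))))
                      (cong (λ p → p + (1ℤ - multipleOf3 (suc (suc a)))) (multipleOf3-consecutive a))
      where split : ∀ p q r → 1ℤ + (p + q) ≡ (p + (q + r)) + (1ℤ - r)
            split = solve-∀
    by-last : multipleOf3 (suc (suc a)) ≡ 0ℤ ⊎ multipleOf3 (suc (suc a)) ≡ 1ℤ → window 0F ≡ 1ℤ ⊎ window 0F ≡ + 2
    by-last (inj₁ e) = inj₂ (trans wrapped (trans first-two (cong (λ p → 1ℤ + (1ℤ - p)) e)))
    by-last (inj₂ e) = inj₁ (trans wrapped (trans first-two (cong (λ p → 1ℤ + (1ℤ - p)) e)))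
  window-1or2 1F = by-first (multipleOf3-01 (suc a))
    where
    a = m′ ℕ.+ suc m′
    wrapped : window 1F ≡ 0ℤ + (multipleOf3 (suc a) + 1ℤ)
    wrapped = cong₂ (λ p q → 0ℤ + (multipleOf3 p + multipleOf3 q)) (toℕ-⊖-wrap 1F (s≤s (s≤s z≤n)) (s≤s (s≤s z≤n)))
                                                                   (toℕ-⊖ 1F (s≤s z≤n))
    by-first : multipleOf3 (suc a) ≡ 0ℤ ⊎ multipleOf3 (suc a) ≡ 1ℤ → window 1F ≡ 1ℤ ⊎ window 1F ≡ + 2
    by-first (inj₁ e) = inj₁ (trans wrapped (cong (λ p → 0ℤ + (p + 1ℤ)) e))
    by-first (inj₂ e) = inj₂ (trans wrapped (cong (λ p → 0ℤ + (p + 1ℤ)) e))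
  window-1or2 (suc (suc z)) = inj₁ (begin
    window (suc (suc z))
      ≡⟨ cong₂ (λ p q → multipleOf3 (suc (suc b)) + (multipleOf3 p + multipleOf3 q))
               (toℕ-⊖ (suc (suc z)) (s≤s (s≤s z≤n))) (toℕ-⊖ (suc (suc z)) (s≤s z≤n)) ⟩
    multipleOf3 (suc (suc b)) + (multipleOf3 b + multipleOf3 (suc b))
      ≡⟨ rotate (multipleOf3 b) (multipleOf3 (suc b)) (multipleOf3 (suc (suc b))) ⟩
    multipleOf3 b + (multipleOf3 (suc b) + multipleOf3 (suc (suc b)))
      ≡⟨ multipleOf3-consecutive b ⟩
    1ℤ ∎)
    where
    open ≡-Reasoning
    b = toℕ z
    rotate : ∀ p q r → r + (p + q) ≡ p + (q + r)
    rotate = solve-∀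

  weight : Fin (suc m′) → Fin n → ℤ
  weight 0F      a = 1ℤ + scale m′ * multipleOf3 (toℕ a)
  weight (suc j) a = alternating (toℕ j)

  verticalWeight : Fin n → ℤ
  verticalWeight z = - ∑[ t < suc m′ ] weightThrough weight t z

  weight-value : ∀ t a → FlowValue 3 (weight t a)
  weight-value 0F a with scale m′ | scale-values m′ | multipleOf3 (toℕ a) | multipleOf3-01 (toℕ a)
  ... | _ | inj₁ refl | _ | inj₁ refl = flowValue 1ℤ
  ... | _ | inj₁ refl | _ | inj₂ refl = flowValue -1ℤ
  ... | _ | inj₂ refl | _ | inj₁ refl = flowValue 1ℤ
  ... | _ | inj₂ refl | _ | inj₂ refl = flowValue (+ 2)
  weight-value (suc j) a with alternating (toℕ j) | alternating-values (toℕ j)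
  ... | _ | inj₁ refl = flowValue -1ℤ
  ... | _ | inj₂ refl = flowValue 1ℤ

  weightThrough-offset-1 : ∀ z → weightThrough weight 0F z ≡ + 3 + scale m′ * window z
  weightThrough-offset-1 z = collect (scale m′) (multipleOf3 (toℕ z)) (multipleOf3 (toℕ (z ⊖ 2))) (multipleOf3 (toℕ (z ⊖ 1)))
    where
    collect : ∀ s p q r → (1ℤ + s * p) + ((1ℤ + s * q) + ((1ℤ + s * r) + 0ℤ)) ≡ + 3 + s * (p + (q + r))
    collect = solve-∀

  verticalWeight-value : ∀ z → FlowValue 3 (verticalWeight z)
  verticalWeight-value z =
    subst (FlowValue 3) (cong (λ p → - (p + ∑[ j < m′ ] triple (alternating (toℕ j)))) (sym (weightThrough-offset-1 z)))
          (vertical-value m′ (window z) (window-1or2 z))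

  steinerTripleSystemWithFlow : HasTSWithFlow 3 (3 ℕ.* n) 1
  steinerTripleSystemWithFlow =
    System.weighted weight verticalWeight ,
    subst (IsTS (3 ℕ.* n) 1) (sym (System.blocks-weighted weight verticalWeight)) steinerTripleSystem ,
    System.values-weighted weight verticalWeight weight-value verticalWeight-value , balanced
    where
    balanced : ∀ x → flowAt (System.weighted weight verticalWeight) x ≡ 0ℤ
    balanced x with Fin.combine-surjective {m = 3} {n = n} x
    ... | i , z , refl = trans (System.flowAt-weighted weight verticalWeight i z)
                               (ℤP.+-inverseʳ (∑[ t < suc m′ ] weightThrough weight t z))

module Doubled (m′ : ℕ) where

  open Bose (suc m′)
  open Cyclic n using (_⊕_; _⊖_)
  open Cyclic 3 using () renaming (_⊕_ to _⊕₃_; _⊖_ to _⊖₃_)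

  v : ℕ
  v = 3 ℕ.* n ℕ.+ 3

  level : Fin 3 → Fin n → Fin v
  level l a = combine l a ↑ˡ 3

  ∞ : Fin 3 → Fin v
  ∞ j = (3 ℕ.* n) ↑ʳ j

  level-injective : ∀ {i z l a} → level i z ≡ level l a → i ≡ l × z ≡ a
  level-injective {i} {z} {l} {a} e = Fin.combine-injective i z l a (Fin.↑ˡ-injective 3 _ _ e)

  level≢∞ : ∀ l a j → level l a ≢ ∞ j
  level≢∞ l a j e with trans (sym (Fin.splitAt-↑ˡ (3 ℕ.* n) (combine l a) 3))
                             (trans (cong (splitAt (3 ℕ.* n)) e) (Fin.splitAt-↑ʳ (3 ℕ.* n) 3 j))
  ... | ()

  ∞-injective : ∀ {j k} → ∞ j ≡ ∞ k → j ≡ k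
  ∞-injective = Fin.↑ʳ-injective (3 ℕ.* n) _ _

  data Point : Fin v → Set where
    at-level : ∀ i z → Point (level i z)
    at-∞     : ∀ j → Point (∞ j)

  point : ∀ x → Point x
  point x with splitAt (3 ℕ.* n) x in eq
  ... | inj₂ j = subst Point (Fin.splitAt⁻¹-↑ʳ eq) (at-∞ j)
  ... | inj₁ y with Fin.combine-surjective {m = 3} {n = n} y
  ...   | i , z , refl = subst Point (Fin.splitAt⁻¹-↑ˡ eq) (at-level i z)

  open Steiner level level-injective

  infinite : Block v
  infinite = ∞ 0F , ∞ 1F , ∞ 2F

  rest : List (Block v)
  rest = (⋃[ t < m′ ] triangles (suc t)) ++ verticals

  extension : Fin 3 → Block v → Block v
  extension 0F (p , q , r) = ∞ 0F , p , q
  extension 1F (p , q , r) = ∞ 1F , p , r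
  extension 2F (p , q , r) = ∞ 2F , q , r

  triangleWeight : Fin 3 → ℤ
  triangleWeight 0F = 1ℤ
  triangleWeight 1F = 1ℤ
  triangleWeight 2F = -[1+ 1 ]

  extensionWeight : Fin 3 → Fin 3 → ℤ
  extensionWeight 0F 0F = 1ℤ
  extensionWeight 0F 1F = -[1+ 1 ]
  extensionWeight 0F 2F = 1ℤ
  extensionWeight 1F 0F = 1ℤ
  extensionWeight 1F 1F = 1ℤ
  extensionWeight 1F 2F = -[1+ 1 ]
  extensionWeight 2F 0F = -[1+ 1 ]
  extensionWeight 2F 1F = 1ℤ
  extensionWeight 2F 2F = 1ℤ

  group : Fin 3 → Fin n → List (Block v × ℤ)
  group l a = (T , triangleWeight l) ∷ (extension 0F T , extensionWeight 0F l) ∷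
              (extension 1F T , extensionWeight 1F l) ∷ (extension 2F T , extensionWeight 2F l) ∷ []
    where T = triangle 0F l a

  doubled : List (Block v × ℤ)
  doubled = copies (1ℤ ∷ -1ℤ ∷ []) (infinite ∷ rest) ++ ⋃[ l < 3 ] ⋃[ a < n ] group l a

  side₁ side₂ : Fin 3 → Fin 3
  side₁ 0F = 0F
  side₁ 1F = 0F
  side₁ 2F = 1F
  side₂ 0F = 1F
  side₂ 1F = 2F
  side₂ 2F = 2F

  module _ (l : Fin 3) (a : Fin n) where

    private
      T = triangle 0F l a
      c = corner T

    extension-corners : ∀ k → extension k T ≡ (∞ k , c (side₁ k) , c (side₂ k))
    extension-corners 0F = refl
    extension-corners 1F = refl
    extension-corners 2F = refl

    ∞≢corner : ∀ k s → ∞ k ≢ c s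
    ∞≢corner k 0F e = level≢∞ l a k (sym e)
    ∞≢corner k 1F e = level≢∞ l (a ⊕ 2) k (sym e)
    ∞≢corner k 2F e = level≢∞ (l ⊕₃ 1) (a ⊕ 1) k (sym e)

    proper-extension : ∀ k → ProperBlock (extension k T)
    proper-extension k rewrite extension-corners k =
      ∞≢corner k (side₁ k) , ∞≢corner k (side₂ k) , sides k (proper-triangle 0F l a)
      where
      sides : ∀ k → ProperBlock T → c (side₁ k) ≢ c (side₂ k)
      sides 0F (p≢q , p≢r , q≢r) = p≢q
      sides 1F (p≢q , p≢r , q≢r) = p≢r
      sides 2F (p≢q , p≢r , q≢r) = q≢r

    χ-extension : ∀ k x → χ x (extension k T) ≡ δ x (∞ k) + (δ x (c (side₁ k)) + (δ x (c (side₂ k)) + 0ℤ))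
    χ-extension k x = trans (χ-proper (proper-extension k) x) (cong (λ B → ∑[ s < 3 ] δ x (corner B s)) (extension-corners k))

    χ-triangle-corners : ∀ x → χ x T ≡ δ x (c 0F) + (δ x (c 1F) + (δ x (c 2F) + 0ℤ))
    χ-triangle-corners = χ-proper (proper-triangle 0F l a)

    pairs-group : ∀ x y → pairCountℤ (map proj₁ (group l a)) x y ≡
      χ x T * χ y T + ∑[ k < 3 ] (χ x (extension k T) * χ y (extension k T))
    pairs-group x y =
      trans (pairCount-∷ T _ x y) (cong (_+_ (χ x T * χ y T))
      (trans (pairCount-∷ (extension 0F T) _ x y) (cong (_+_ (χ x (extension 0F T) * χ y (extension 0F T)))
      (trans (pairCount-∷ (extension 1F T) _ x y) (cong (_+_ (χ x (extension 1F T) * χ y (extension 1F T)))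
      (pairCount-∷ (extension 2F T) [] x y))))))

    χ-level-extension : ∀ k i z →
      χ (level i z) (extension k T) ≡ 0ℤ + (δ (level i z) (c (side₁ k)) + (δ (level i z) (c (side₂ k)) + 0ℤ))
    χ-level-extension k i z = trans (χ-extension k (level i z))
      (cong (_+ (δ (level i z) (c (side₁ k)) + (δ (level i z) (c (side₂ k)) + 0ℤ))) (δ-≢ (level≢∞ i z k)))

    -- at two level points, the three extensions cover the sides of T once more
    pairs-group-levels : ∀ {i z j w} → level i z ≢ level j w →
      pairCountℤ (map proj₁ (group l a)) (level i z) (level j w) ≡ + 2 * pairCountℤ [ T ] (level i z) (level j w)
    pairs-group-levels {i} {z} {j} {w} x≢y = begin
      pairCountℤ (map proj₁ (group l a)) x y
        ≡⟨ pairs-group x y ⟩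
      _
        ≡⟨ cong₂ _+_ (cong₂ _*_ (χ-triangle-corners x) (χ-triangle-corners y))
             (cong₂ _+_ (cong₂ _*_ (χ-level-extension 0F i z) (χ-level-extension 0F j w))
             (cong₂ _+_ (cong₂ _*_ (χ-level-extension 1F i z) (χ-level-extension 1F j w))
             (cong (_+ 0ℤ) (cong₂ _*_ (χ-level-extension 2F i z) (χ-level-extension 2F j w))))) ⟩
      _
        ≡⟨ doubles (δ x (c 0F)) (δ x (c 1F)) (δ x (c 2F)) (δ y (c 0F)) (δ y (c 1F)) (δ y (c 2F)) ⟩
      + 2 * ((δ x (c 0F) + (δ x (c 1F) + (δ x (c 2F) + 0ℤ))) * (δ y (c 0F) + (δ y (c 1F) + (δ y (c 2F) + 0ℤ))))
        + (δ x (c 0F) * δ y (c 0F) + (δ x (c 1F) * δ y (c 1F) + δ x (c 2F) * δ y (c 2F)))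
        ≡⟨ cong₂ _+_ (cong (λ p → + 2 * p) (sym (trans (pairCount-[ T ] x y) (cong₂ _*_ (χ-triangle-corners x) (χ-triangle-corners y)))))
                     (cong₂ _+_ (δ-δ-≢ x≢y (c 0F)) (cong₂ _+_ (δ-δ-≢ x≢y (c 1F)) (δ-δ-≢ x≢y (c 2F)))) ⟩
      + 2 * pairCountℤ [ T ] x y + 0ℤ
        ≡⟨ ℤP.+-identityʳ _ ⟩
      + 2 * pairCountℤ [ T ] x y ∎
      where
      open ≡-Reasoning
      x = level i z
      y = level j w
      doubles : ∀ p q r p′ q′ r′ →
        (p + (q + (r + 0ℤ))) * (p′ + (q′ + (r′ + 0ℤ))) + ((0ℤ + (p + (q + 0ℤ))) * (0ℤ + (p′ + (q′ + 0ℤ))) +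
        ((0ℤ + (p + (r + 0ℤ))) * (0ℤ + (p′ + (r′ + 0ℤ))) + ((0ℤ + (q + (r + 0ℤ))) * (0ℤ + (q′ + (r′ + 0ℤ))) + 0ℤ))) ≡
        + 2 * ((p + (q + (r + 0ℤ))) * (p′ + (q′ + (r′ + 0ℤ)))) + (p * p′ + (q * q′ + r * r′))
      doubles = solve-∀

    χ-∞-extension : ∀ k j → χ (∞ j) (extension k T) ≡ δ j k
    χ-∞-extension k j = trans (χ-extension k (∞ j))
      (trans (cong₂ _+_ (δ-injective ∞-injective j k)
                        (cong₂ _+_ (δ-≢ (∞≢corner j (side₁ k))) (cong (_+ 0ℤ) (δ-≢ (∞≢corner j (side₂ k))))))
             (ℤP.+-identityʳ (δ j k)))

    χ-∞-triangle : ∀ j → χ (∞ j) T ≡ 0ℤ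
    χ-∞-triangle j = trans (χ-triangle-corners (∞ j))
      (cong₂ _+_ (δ-≢ (∞≢corner j 0F)) (cong₂ _+_ (δ-≢ (∞≢corner j 1F)) (cong (_+ 0ℤ) (δ-≢ (∞≢corner j 2F)))))

    pairs-group-∞ : ∀ x j → pairCountℤ (map proj₁ (group l a)) x (∞ j) ≡ χ x (extension j T)
    pairs-group-∞ x j = begin
      pairCountℤ (map proj₁ (group l a)) x (∞ j)
        ≡⟨ pairs-group x (∞ j) ⟩
      χ x T * χ (∞ j) T + ∑[ k < 3 ] (χ x (extension k T) * χ (∞ j) (extension k T))
        ≡⟨ cong₂ _+_ (trans (cong (χ x T *_) (χ-∞-triangle j)) (ℤP.*-zeroʳ (χ x T)))
                     (sum-cong-≗ λ k → trans (cong (χ x (extension k T) *_) (χ-∞-extension k j))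
                                             (ℤP.*-comm (χ x (extension k T)) (δ j k))) ⟩
      0ℤ + ∑[ k < 3 ] (δ j k * χ x (extension k T))
        ≡⟨ ℤP.+-identityˡ _ ⟩
      ∑[ k < 3 ] (δ j k * χ x (extension k T))
        ≡⟨ ∑-δ j (λ k → χ x (extension k T)) ⟩
      χ x (extension j T) ∎
      where open ≡-Reasoning

    pairs-group-∞∞ : ∀ {j j′} → j ≢ j′ → pairCountℤ (map proj₁ (group l a)) (∞ j) (∞ j′) ≡ 0ℤ
    pairs-group-∞∞ {j} {j′} j≢j′ = trans (pairs-group-∞ (∞ j) j′) (trans (χ-∞-extension j′ j) (δ-≢ j≢j′))

    flowAt-group : ∀ x → flowAt (group l a) x ≡ χ x T * triangleWeight l + ∑[ k < 3 ] (χ x (extension k T) * extensionWeight k l)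
    flowAt-group x =
      trans (flowAt-∷ T _ _ x) (cong (_+_ (χ x T * triangleWeight l))
      (trans (flowAt-∷ (extension 0F T) _ _ x) (cong (_+_ (χ x (extension 0F T) * extensionWeight 0F l))
      (trans (flowAt-∷ (extension 1F T) _ _ x) (cong (_+_ (χ x (extension 1F T) * extensionWeight 1F l))
      (flowAt-∷ (extension 2F T) _ [] x))))))

    -- the weight of the group's blocks through corner s of T
    cornerWeight : Fin 3 → ℤ
    cornerWeight 0F = triangleWeight l + (extensionWeight 0F l + extensionWeight 1F l)
    cornerWeight 1F = triangleWeight l + (extensionWeight 0F l + extensionWeight 2F l)
    cornerWeight 2F = triangleWeight l + (extensionWeight 1F l + extensionWeight 2F l)

    flowAt-group-level : ∀ i z → flowAt (group l a) (level i z) ≡ ∑[ s < 3 ] (δ (level i z) (c s) * cornerWeight s)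
    flowAt-group-level i z = begin
      flowAt (group l a) x
        ≡⟨ flowAt-group x ⟩
      χ x T * triangleWeight l + ∑[ k < 3 ] (χ x (extension k T) * extensionWeight k l)
        ≡⟨ cong₂ _+_ (cong (_* triangleWeight l) (χ-triangle-corners x))
                     (sum-cong-≗ λ k → cong (_* extensionWeight k l) (χ-level-extension k i z)) ⟩
      _
        ≡⟨ regroup (δ x (c 0F)) (δ x (c 1F)) (δ x (c 2F))
                   (triangleWeight l) (extensionWeight 0F l) (extensionWeight 1F l) (extensionWeight 2F l) ⟩
      ∑[ s < 3 ] (δ x (c s) * cornerWeight s) ∎
      where
      open ≡-Reasoning
      x = level i z
      regroup : ∀ p q r t e₀ e₁ e₂ →
        (p + (q + (r + 0ℤ))) * t + ((0ℤ + (p + (q + 0ℤ))) * e₀ + ((0ℤ + (p + (r + 0ℤ))) * e₁ + ((0ℤ + (q + (r + 0ℤ))) * e₂ + 0ℤ))) ≡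
        p * (t + (e₀ + e₁)) + (q * (t + (e₀ + e₂)) + (r * (t + (e₁ + e₂)) + 0ℤ))
      regroup = solve-∀

    flowAt-group-∞ : ∀ j → flowAt (group l a) (∞ j) ≡ extensionWeight j l
    flowAt-group-∞ j = begin
      flowAt (group l a) (∞ j)
        ≡⟨ flowAt-group (∞ j) ⟩
      χ (∞ j) T * triangleWeight l + ∑[ k < 3 ] (χ (∞ j) (extension k T) * extensionWeight k l)
        ≡⟨ cong₂ _+_ (cong (_* triangleWeight l) (χ-∞-triangle j))
                     (sum-cong-≗ λ k → cong (_* extensionWeight k l) (χ-∞-extension k j)) ⟩
      0ℤ + ∑[ k < 3 ] (δ j k * extensionWeight k l)
        ≡⟨ ℤP.+-identityˡ _ ⟩
      ∑[ k < 3 ] (δ j k * extensionWeight k l)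
        ≡⟨ ∑-δ j (λ k → extensionWeight k l) ⟩
      extensionWeight j l ∎
      where open ≡-Reasoning

  ∞∉triangle : ∀ j t l a s → ∞ j ≢ corner (triangle t l a) s
  ∞∉triangle j t l a s e =
    level≢∞ (triangle-levels s ⟨$⟩ʳ l) (triangle-residues t s ⟨$⟩ʳ a) j (sym (trans e (triangle-shape t l a s)))

  ∞∉vertical : ∀ j a s → ∞ j ≢ corner (vertical a) s
  ∞∉vertical j a s e = level≢∞ s a j (sym (trans e (vertical-corner a s)))

  pairs-rest-∞ : ∀ x j → pairCountℤ rest x (∞ j) ≡ 0ℤ
  pairs-rest-∞ x j = pairCount-absent x (All.++⁺
    (All-⋃ (λ t → triangles (suc t)) λ t → All-triangles (suc t) λ l a →
      χ-absent (proper-triangle (suc t) l a) (∞ j) (∞∉triangle j (suc t) l a))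
    (All-verticals λ a → χ-absent (proper-vertical a) (∞ j) (∞∉vertical j a)))

  proper-infinite : ProperBlock infinite
  proper-infinite = (λ e → 0≢1 (∞-injective e)) , (λ e → 0≢2 (∞-injective e)) , (λ e → 1≢2 (∞-injective e))
    where
    0≢1 : 0F ≢ 1F
    0≢1 ()
    0≢2 : 0F ≢ 2F
    0≢2 ()
    1≢2 : 1F ≢ 2F
    1≢2 ()

  infinite-corner : ∀ s → corner infinite s ≡ ∞ s
  infinite-corner 0F = refl
  infinite-corner 1F = refl
  infinite-corner 2F = refl

  χ-level-infinite : ∀ i z → χ (level i z) infinite ≡ 0ℤ
  χ-level-infinite i z = χ-absent proper-infinite (level i z) (λ s e → level≢∞ i z s (trans e (infinite-corner s)))

  χ-∞-infinite : ∀ j → χ (∞ j) infinite ≡ 1ℤ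
  χ-∞-infinite j = trans (χ-proper proper-infinite (∞ j))
    (trans (sum-cong-≗ (λ k → trans (cong (δ (∞ j)) (infinite-corner k)) (δ-injective ∞-injective j k))) (∑-δ-1 j))

  private
    groups : List (Block v × ℤ)
    groups = ⋃[ l < 3 ] ⋃[ a < n ] group l a

    pairCount-doubled : ∀ x y → pairCountℤ (map proj₁ doubled) x y ≡
      + 2 * pairCountℤ (infinite ∷ rest) x y + ∑[ l < 3 ] ∑[ a < n ] pairCountℤ (map proj₁ (group l a)) x y
    pairCount-doubled x y = begin
      pairCountℤ (map proj₁ doubled) x y
        ≡⟨ cong (λ Bs → pairCountℤ Bs x y) (List.map-++ proj₁ (copies (1ℤ ∷ -1ℤ ∷ []) (infinite ∷ rest)) groups) ⟩
      pairCountℤ (map proj₁ (copies (1ℤ ∷ -1ℤ ∷ []) (infinite ∷ rest)) ++ map proj₁ groups) x y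
        ≡⟨ pairCountℤ-++ (map proj₁ (copies (1ℤ ∷ -1ℤ ∷ []) (infinite ∷ rest))) (map proj₁ groups) x y ⟩
      _
        ≡⟨ cong₂ _+_ (trans (cong +_ (pairCount-copies (infinite ∷ rest) (1ℤ ∷ -1ℤ ∷ []) x y))
                            (ℤP.pos-* 2 (pairCount (infinite ∷ rest) x y)))
                     (trans (cong (λ Bs → pairCountℤ Bs x y) blocks-groups)
                            (trans (pairCount-⋃ (λ l → ⋃[ a < n ] map proj₁ (group l a)) x y)
                                   (sum-cong-≗ λ l → pairCount-⋃ (λ a → map proj₁ (group l a)) x y))) ⟩
      + 2 * pairCountℤ (infinite ∷ rest) x y + ∑[ l < 3 ] ∑[ a < n ] pairCountℤ (map proj₁ (group l a)) x y ∎
      where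
      open ≡-Reasoning
      blocks-groups : map proj₁ groups ≡ ⋃[ l < 3 ] ⋃[ a < n ] map proj₁ (group l a)
      blocks-groups = trans (map-⋃ proj₁ (λ l → ⋃[ a < n ] group l a)) (⋃-cong λ l → map-⋃ proj₁ (group l))

    pairCount-steinerBlocks : ∀ x y →
      pairCountℤ steinerBlocks x y ≡ ∑[ l < 3 ] ∑[ a < n ] pairCountℤ [ triangle 0F l a ] x y + pairCountℤ rest x y
    pairCount-steinerBlocks x y = begin
      pairCountℤ ((triangles 0F ++ ⋃[ t < m′ ] triangles (suc t)) ++ verticals) x y
        ≡⟨ pairCountℤ-++ (triangles 0F ++ ⋃[ t < m′ ] triangles (suc t)) verticals x y ⟩
      pairCountℤ (triangles 0F ++ ⋃[ t < m′ ] triangles (suc t)) x y + pairCountℤ verticals x y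
        ≡⟨ cong (_+ pairCountℤ verticals x y) (pairCountℤ-++ (triangles 0F) (⋃[ t < m′ ] triangles (suc t)) x y) ⟩
      pairCountℤ (triangles 0F) x y + pairCountℤ (⋃[ t < m′ ] triangles (suc t)) x y + pairCountℤ verticals x y
        ≡⟨ ℤP.+-assoc (pairCountℤ (triangles 0F) x y) (pairCountℤ (⋃[ t < m′ ] triangles (suc t)) x y) (pairCountℤ verticals x y) ⟩
      pairCountℤ (triangles 0F) x y + (pairCountℤ (⋃[ t < m′ ] triangles (suc t)) x y + pairCountℤ verticals x y)
        ≡⟨ cong₂ _+_ (trans (pairCount-⋃ (λ l → ⋃[ a < n ] [ triangle 0F l a ]) x y)
                            (sum-cong-≗ λ l → pairCount-⋃ (λ a → [ triangle 0F l a ]) x y))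
                     (sym (pairCountℤ-++ (⋃[ t < m′ ] triangles (suc t)) verticals x y)) ⟩
      ∑[ l < 3 ] ∑[ a < n ] pairCountℤ [ triangle 0F l a ] x y + pairCountℤ rest x y ∎
      where open ≡-Reasoning

  pairs-levels : ∀ {i z j w} → level i z ≢ level j w → pairCountℤ (map proj₁ doubled) (level i z) (level j w) ≡ + 2
  pairs-levels {i} {z} {j} {w} x≢y = begin
    pairCountℤ (map proj₁ doubled) x y
      ≡⟨ pairCount-doubled x y ⟩
    + 2 * pairCountℤ (infinite ∷ rest) x y + ∑[ l < 3 ] ∑[ a < n ] pairCountℤ (map proj₁ (group l a)) x y
      ≡⟨ cong₂ (λ p q → + 2 * p + q) without-infinite with-extensions ⟩
    + 2 * pairCountℤ rest x y + + 2 * offset-1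
      ≡⟨ factor (pairCountℤ rest x y) offset-1 ⟩
    + 2 * (offset-1 + pairCountℤ rest x y)
      ≡⟨ cong (λ p → + 2 * p) (trans (sym (pairCount-steinerBlocks x y)) (steiner-pairs i z j w x≢y)) ⟩
    + 2 ∎
    where
    open ≡-Reasoning
    x = level i z
    y = level j w
    offset-1 = ∑[ l < 3 ] ∑[ a < n ] pairCountℤ [ triangle 0F l a ] x y
    without-infinite : pairCountℤ (infinite ∷ rest) x y ≡ pairCountℤ rest x y
    without-infinite = trans (pairCount-∷ infinite rest x y)
      (trans (cong (λ c → c * χ y infinite + pairCountℤ rest x y) (χ-level-infinite i z)) (ℤP.+-identityˡ (pairCountℤ rest x y)))
    with-extensions : ∑[ l < 3 ] ∑[ a < n ] pairCountℤ (map proj₁ (group l a)) x y ≡ + 2 * offset-1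
    with-extensions = trans (sum-cong-≗ λ l → sum-cong-≗ λ a → pairs-group-levels l a {i} {z} {j} {w} x≢y)
                            (sym (∑∑-distribˡ (+ 2) (λ l a → pairCountℤ [ triangle 0F l a ] x y)))
    factor : ∀ r t → + 2 * r + + 2 * t ≡ + 2 * (t + r)
    factor = solve-∀

  pairs-level-∞ : ∀ i z j → pairCountℤ (map proj₁ doubled) (level i z) (∞ j) ≡ + 2
  pairs-level-∞ i z j = begin
    pairCountℤ (map proj₁ doubled) x (∞ j)
      ≡⟨ pairCount-doubled x (∞ j) ⟩
    + 2 * pairCountℤ (infinite ∷ rest) x (∞ j) + ∑[ l < 3 ] ∑[ a < n ] pairCountℤ (map proj₁ (group l a)) x (∞ j)
      ≡⟨ cong₂ (λ p q → + 2 * p + q) nowhere-else (sum-cong-≗ λ l → sum-cong-≗ λ a → trans (pairs-group-∞ l a x j) (sides l a)) ⟩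
    + 2 * 0ℤ + ∑[ l < 3 ] ∑[ a < n ] (δ x (c₁ l a) + δ x (c₂ l a))
      ≡⟨ cong (_+_ 0ℤ) (∑∑-distrib-+ (λ l a → δ x (c₁ l a)) (λ l a → δ x (c₂ l a))) ⟩
    0ℤ + (∑[ l < 3 ] ∑[ a < n ] δ x (c₁ l a) + ∑[ l < 3 ] ∑[ a < n ] δ x (c₂ l a))
      ≡⟨ cong (_+_ 0ℤ) (cong₂ _+_ (∑∑-δ-corner-1 0F (side₁ j) i z) (∑∑-δ-corner-1 0F (side₂ j) i z)) ⟩
    + 2 ∎
    where
    open ≡-Reasoning
    x = level i z
    c₁ c₂ : Fin 3 → Fin n → Fin v
    c₁ l a = corner (triangle 0F l a) (side₁ j)
    c₂ l a = corner (triangle 0F l a) (side₂ j)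
    nowhere-else : pairCountℤ (infinite ∷ rest) x (∞ j) ≡ 0ℤ
    nowhere-else = trans (pairCount-∷ infinite rest x (∞ j))
      (cong₂ (λ c p → c * χ (∞ j) infinite + p) (χ-level-infinite i z) (pairs-rest-∞ x j))
    sides : ∀ l a → χ x (extension j (triangle 0F l a)) ≡ δ x (c₁ l a) + δ x (c₂ l a)
    sides l a = trans (χ-level-extension l a j i z) (trans (ℤP.+-identityˡ _) (cong (_+_ (δ x (c₁ l a))) (ℤP.+-identityʳ _)))

  pairs-∞∞ : ∀ {j j′} → j ≢ j′ → pairCountℤ (map proj₁ doubled) (∞ j) (∞ j′) ≡ + 2
  pairs-∞∞ {j} {j′} j≢j′ = begin
    pairCountℤ (map proj₁ doubled) (∞ j) (∞ j′)
      ≡⟨ pairCount-doubled (∞ j) (∞ j′) ⟩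
    + 2 * pairCountℤ (infinite ∷ rest) (∞ j) (∞ j′) + ∑[ l < 3 ] ∑[ a < n ] pairCountℤ (map proj₁ (group l a)) (∞ j) (∞ j′)
      ≡⟨ cong₂ _+_ (cong (λ p → + 2 * p) (trans (pairCount-∷ infinite rest (∞ j) (∞ j′))
                                          (cong₂ _+_ (cong₂ _*_ (χ-∞-infinite j) (χ-∞-infinite j′)) (pairs-rest-∞ (∞ j) j′))))
                   (∑∑-zero λ l a → pairs-group-∞∞ l a j≢j′) ⟩
    + 2 ∎
    where open ≡-Reasoning

  private
    flowAt-doubled : ∀ x → flowAt doubled x ≡ ∑[ l < 3 ] ∑[ a < n ] flowAt (group l a) x
    flowAt-doubled x = begin
      flowAt doubled x
        ≡⟨ flowAt-++ (copies (1ℤ ∷ -1ℤ ∷ []) (infinite ∷ rest)) groups x ⟩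
      flowAt (copies (1ℤ ∷ -1ℤ ∷ []) (infinite ∷ rest)) x + flowAt groups x
        ≡⟨ cong₂ _+_ (flowAt-copies (infinite ∷ rest) (1ℤ ∷ -1ℤ ∷ []) x)
                     (trans (flowAt-⋃ (λ l → ⋃[ a < n ] group l a) x) (sum-cong-≗ λ l → flowAt-⋃ (group l) x)) ⟩
      0ℤ + ∑[ l < 3 ] ∑[ a < n ] flowAt (group l a) x
        ≡⟨ ℤP.+-identityˡ _ ⟩
      ∑[ l < 3 ] ∑[ a < n ] flowAt (group l a) x ∎
      where open ≡-Reasoning

    balanced-level : ∀ i z → flowAt doubled (level i z) ≡ 0ℤ
    balanced-level i z = begin
      flowAt doubled x
        ≡⟨ flowAt-doubled x ⟩
      ∑[ l < 3 ] ∑[ a < n ] flowAt (group l a) x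
        ≡⟨ sum-cong-≗ (λ l → sum-cong-≗ λ a → flowAt-group-level l a i z) ⟩
      ∑[ l < 3 ] ∑[ a < n ] ∑[ s < 3 ] (δ x (corner (triangle 0F l a) s) * cornerWeight l a s)
        ≡⟨ Triangles.∑∑-∑-δ-corner 0F i z (λ s l a → cornerWeight l a s) ⟩
      cornerWeight i z 0F + (cornerWeight i (z ⊖ 2) 1F + (cornerWeight (i ⊖₃ 1) (z ⊖ 1) 2F + 0ℤ))
        ≡⟨ cancels i ⟩
      0ℤ ∎
      where
      open ≡-Reasoning
      x = level i z
      cancels : ∀ i → cornerWeight i z 0F + (cornerWeight i (z ⊖ 2) 1F + (cornerWeight (i ⊖₃ 1) (z ⊖ 1) 2F + 0ℤ)) ≡ 0ℤ
      cancels 0F = refl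
      cancels 1F = refl
      cancels 2F = refl

    balanced-∞ : ∀ j → flowAt doubled (∞ j) ≡ 0ℤ
    balanced-∞ j = begin
      flowAt doubled (∞ j)
        ≡⟨ flowAt-doubled (∞ j) ⟩
      ∑[ l < 3 ] ∑[ a < n ] flowAt (group l a) (∞ j)
        ≡⟨ sum-cong-≗ (λ l → sum-cong-≗ λ a → flowAt-group-∞ l a j) ⟩
      ∑[ l < 3 ] ∑[ a < n ] extensionWeight j l
        ≡⟨ ∑-comm {3} {n} (λ l a → extensionWeight j l) ⟩
      ∑[ a < n ] ∑[ l < 3 ] extensionWeight j l
        ≡⟨ trans (sum-cong-≗ {n} (λ a → cancels j)) (sum-replicate-zero n) ⟩
      0ℤ ∎
      where
      open ≡-Reasoning
      cancels : ∀ j → ∑[ l < 3 ] extensionWeight j l ≡ 0ℤ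
      cancels 0F = refl
      cancels 1F = refl
      cancels 2F = refl

  twofoldTripleSystemWithFlow : HasTSWithFlow 3 v 2
  twofoldTripleSystemWithFlow = doubled , (proper , λ x y x≢y → ℤP.+-injective (pairs x y x≢y)) , (values , balanced)
    where
    proper-rest : All ProperBlock rest
    proper-rest = All.++⁺ (All-⋃ (λ t → triangles (suc t)) λ t → All-triangles (suc t) (proper-triangle (suc t)))
                          (All-verticals proper-vertical)

    proper : All ProperBlock (map proj₁ doubled)
    proper = subst (All ProperBlock) (sym (List.map-++ proj₁ (copies (1ℤ ∷ -1ℤ ∷ []) (infinite ∷ rest)) groups))
      (All.++⁺ (proper-copies (infinite ∷ rest) (proper-infinite ∷ proper-rest) (1ℤ ∷ -1ℤ ∷ []))
               (subst (All ProperBlock) (sym (trans (map-⋃ proj₁ (λ l → ⋃[ a < n ] group l a)) (⋃-cong λ l → map-⋃ proj₁ (group l))))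
                 (All-⋃ (λ l → ⋃[ a < n ] map proj₁ (group l a)) λ l → All-⋃ (λ a → map proj₁ (group l a)) λ a →
                   proper-triangle 0F l a ∷ proper-extension l a 0F ∷ proper-extension l a 1F ∷ proper-extension l a 2F ∷ [])))

    triangleWeight-value : ∀ l → FlowValue 3 (triangleWeight l)
    triangleWeight-value 0F = flowValue 1ℤ
    triangleWeight-value 1F = flowValue 1ℤ
    triangleWeight-value 2F = flowValue -[1+ 1 ]

    extensionWeight-value : ∀ k l → FlowValue 3 (extensionWeight k l)
    extensionWeight-value 0F 0F = flowValue 1ℤ
    extensionWeight-value 0F 1F = flowValue -[1+ 1 ]
    extensionWeight-value 0F 2F = flowValue 1ℤ
    extensionWeight-value 1F 0F = flowValue 1ℤ
    extensionWeight-value 1F 1F = flowValue 1ℤ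
    extensionWeight-value 1F 2F = flowValue -[1+ 1 ]
    extensionWeight-value 2F 0F = flowValue -[1+ 1 ]
    extensionWeight-value 2F 1F = flowValue 1ℤ
    extensionWeight-value 2F 2F = flowValue 1ℤ

    values : All (FlowValue 3 ∘ proj₂) doubled
    values = All.++⁺ (values-copies (infinite ∷ rest) (1ℤ ∷ -1ℤ ∷ []) (flowValue 1ℤ ∷ flowValue -1ℤ ∷ []))
      (All-⋃ (λ l → ⋃[ a < n ] group l a) λ l → All-⋃ (group l) λ a →
        triangleWeight-value l ∷ extensionWeight-value 0F l ∷ extensionWeight-value 1F l ∷ extensionWeight-value 2F l ∷ [])

    pairs : ∀ x y → x ≢ y → pairCountℤ (map proj₁ doubled) x y ≡ + 2
    pairs x y x≢y with point x | point y
    ... | at-level i z | at-level j w = pairs-levels {i} {z} {j} {w} x≢y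
    ... | at-level i z | at-∞ j       = pairs-level-∞ i z j
    ... | at-∞ j       | at-level i z = trans (cong +_ (pairCount-comm (map proj₁ doubled) (∞ j) (level i z))) (pairs-level-∞ i z j)
    ... | at-∞ j       | at-∞ j′      = pairs-∞∞ (λ j≡j′ → x≢y (cong ∞ j≡j′))

    balanced : ∀ x → flowAt doubled x ≡ 0ℤ
    balanced x with point x
    ... | at-level i z = balanced-level i z
    ... | at-∞ j       = balanced-∞ j

ts-6-2 : List (Block 6)
ts-6-2 = (0F , 1F , 2F) ∷ (0F , 1F , 3F) ∷ (0F , 2F , 4F) ∷ (0F , 3F , 5F) ∷ (0F , 4F , 5F) ∷
         (1F , 2F , 5F) ∷ (1F , 3F , 4F) ∷ (1F , 4F , 5F) ∷ (2F , 3F , 4F) ∷ (2F , 3F , 5F) ∷ []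

ts-6-2-isTS : IsTS 6 2 ts-6-2
ts-6-2-isTS = toWitness {a? = All.all? properBlock? ts-6-2} _ ,
              toWitness {a? = Fin.all? λ x → Fin.all? λ y → ¬? (x ≟ y) →-dec (pairCount ts-6-2 x y ℕP.≟ 2)} _

odd-order : ∀ q l → 1 ≤ l → ¬ (q ≡ 0 × l ≡ 1) → HasTSWithFlow 3 (3 ℕ.* suc (q ℕ.+ q)) l
odd-order zero    1             _ excluded = ⊥-elim (excluded (refl , refl))
odd-order (suc q) 1             _ _        = BoseFlow.steinerTripleSystemWithFlow q
odd-order q       (suc (suc l)) _ _        =
  subst (HasTSWithFlow 3 _) (ℕP.*-identityʳ (suc (suc l)))
        (multiple-withFlow (Bose.steinerTripleSystem q) (suc (suc l)) (s≤s (s≤s z≤n)))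

private
  twofold-order : ∀ q → 3 ℕ.* suc (suc q ℕ.+ suc q) ℕ.+ 3 ≡ 6 ℕ.* suc (suc q)
  twofold-order = ℕ-Solver.solve-∀

even-order : ∀ q r → 1 ≤ r → ¬ (q ≡ 0 × r ≡ 1) → HasTSWithFlow 3 (6 ℕ.* suc q) (r ℕ.* 2)
even-order zero    1             _ excluded = ⊥-elim (excluded (refl , refl))
even-order zero    (suc (suc r)) _ _        = multiple-withFlow ts-6-2-isTS (suc (suc r)) (s≤s (s≤s z≤n))
even-order (suc q) 1             _ _        =
  subst (λ v → HasTSWithFlow 3 v 2) (twofold-order q) (Doubled.twofoldTripleSystemWithFlow q)
even-order (suc q) (suc (suc r)) _ _        =
  subst (λ v → HasTSWithFlow 3 v (suc (suc r) ℕ.* 2)) (twofold-order q)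
        (multiple-withFlow (proj₁ (proj₂ (Doubled.twofoldTripleSystemWithFlow q))) (suc (suc r)) (s≤s (s≤s z≤n)))

positive-multiple : ∀ {k d} .{{_ : NonZero d}} → 1 ≤ k → k % d ≡ 0 → ∃ λ q → k ≡ suc q ℕ.* d
positive-multiple {k} {d} 1≤k k%d≡0 with k / d | m≡m%n+[m/n]*n k d
... | zero  | k≡ = ⊥-elim (ℕP.<⇒≢ 1≤k (sym (trans k≡ (cong (ℕ._+ 0) k%d≡0))))
... | suc q | k≡ = q , trans k≡ (cong (ℕ._+ suc q ℕ.* d) k%d≡0)

mainTheorem10 : (v l : ℕ) → 1 ≤ v → 1 ≤ l →
    ¬ ((v ≡ 3) × (l ≡ 1)) → ¬ ((v ≡ 6) × (l ≡ 2)) →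
    ((v % 6 ≡ 3) ⊎ ((v % 6 ≡ 0) × (l % 2 ≡ 0))) →
    HasTSWithFlow 3 v l
mainTheorem10 v l _ 1≤l not-3-1 _ (inj₁ v%6≡3) =
  subst (λ u → HasTSWithFlow 3 u l) (sym v≡)
        (odd-order q l 1≤l (λ (q≡0 , l≡1) → not-3-1 (trans v≡ (cong (λ p → 3 ℕ.* suc (p ℕ.+ p)) q≡0) , l≡1)))
  where
  q = v / 6
  v≡ : v ≡ 3 ℕ.* suc (q ℕ.+ q)
  v≡ = trans (m≡m%n+[m/n]*n v 6) (trans (cong (ℕ._+ q ℕ.* 6) v%6≡3) (order q))
    where order : ∀ q → 3 ℕ.+ q ℕ.* 6 ≡ 3 ℕ.* suc (q ℕ.+ q)
          order = ℕ-Solver.solve-∀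
mainTheorem10 v l 1≤v 1≤l _ not-6-2 (inj₂ (v%6≡0 , l%2≡0))
  with positive-multiple 1≤v v%6≡0 | positive-multiple 1≤l l%2≡0
... | q , v≡ | r , l≡ =
  subst₂ (HasTSWithFlow 3) (sym (trans v≡ (ℕP.*-comm (suc q) 6))) (sym l≡)
    (even-order q (suc r) (s≤s z≤n)
      (λ (q≡0 , r≡0) → not-6-2 (trans v≡ (cong (λ p → suc p ℕ.* 6) q≡0) , trans l≡ (cong (ℕ._* 2) r≡0))))
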